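{- Let $G$ and $H$ be primitive strongly regular graphs with the same adjacency cosine. Let $A$ be the adjacency matrix of $G$ and $\tau$ the least eigenvalue of $A$. If $\varphi: V(G)\to V(H)$ is a homomorphism from $G$ to $H$, then $(A - \tau I)E_H^\varphi = 0$.
   Context: A graph is strongly regular with parameters $(n,k,\lambda,\mu)$ if it has $n$ vertices, is $k$-regular, every pair of adjacent vertices has $\lambda$ common neighbors and every pair of distinct non-adjacent vertices has $\mu$ common neighbors. It is primitive if neither it nor its complement is disconnected. A primitive strongly regular graph has exactly three distinct adjacency eigenvalues $k>\theta>\tau$, with $\tau<0$. A homomorphism $\varphi$ from $G$ to $H$ is a map $V(G)\to V(H)$ with $\varphi(u)\sim\varphi(v)$ whenever $u\sim v$. For a primitive strongly regular graph $H$ with parameters $(n,k,\lambda,\mu)$ and least eigenvalue $\tau$, its adjacency cosine is $\tau/k$, its non-adjacency cosine is $(-\tau-1)/(n-k-1)$, and its cosine matrix $E_H$ is the $V(H)\times V(H)$ matrix with $(E_H)_{xy}=1$ if $x=y$, $\tau/k$ if $x\sim y$, and $(-\tau-1)/(n-k-1)$ if $x\neq y$ and $x\not\sim y$ (equivalently, $E_H=\frac{n}{m_\tau}E_\tau$ where $E_\tau$ is the orthogonal projection onto the $\tau$-eigenspace and $m_\tau$ its dimension). For a map $\varphi:V(G)\to V(H)$, $E_H^\varphi$ is the $V(G)\times V(G)$ matrix with $(E_H^\varphi)_{uv}=(E_H)_{\varphi(u)\varphi(v)}$. -}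

module Defs where

open import Level using (0ℓ)
open import Data.Nat using (ℕ; zero; suc)
open import Data.Fin using (Fin; zero; suc; _≟_)
open import Data.Bool using (Bool; true; false; if_then_else_; _∧_; not)
open import Data.Product using (Σ; ∃; _×_; _,_)
open import Relation.Nullary using (¬_; does; yes; no)
open import Data.Empty using (⊥-elim)
open import Relation.Binary.PropositionalEquality using (_≡_; _≢_; refl; sym; cong)
open import Relation.Binary.Structures using (IsTotalOrder)
open import Algebra.Bundles using (CommutativeRing)

-- The real numbers: a Dedekind-complete ordered field.
-- (The standard library has no reals; any model of this record is,
-- classically, isomorphic to ℝ.)  Inverse is total with 0⁻¹ arbitrary.

record RealField : Set₁ where
  field
    commutativeRing : CommutativeRing 0ℓ 0ℓ
  open CommutativeRing commutativeRing public hiding (zero)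
  field
    _≤_          : Carrier → Carrier → Set
    isTotalOrder : IsTotalOrder _≈_ _≤_
    +-monoˡ-≤    : ∀ {x y} z → x ≤ y → (x + z) ≤ (y + z)
    *-nonneg     : ∀ {x y} → 0# ≤ x → 0# ≤ y → 0# ≤ (x * y)
    0≉1          : ¬ (0# ≈ 1#)
    _⁻¹          : Carrier → Carrier
    ⁻¹-inverse   : ∀ x → ¬ (x ≈ 0#) → (x * (x ⁻¹)) ≈ 1#
    lub          : (P : Carrier → Set) → ∃ P →
                   (∃ λ b → ∀ x → P x → x ≤ b) →
                   ∃ λ s → (∀ x → P x → x ≤ s) ×
                           (∀ b → (∀ x → P x → x ≤ b) → s ≤ b)

  ι : ℕ → Carrier
  ι zero    = 0#
  ι (suc n) = 1# + ι n

  Σ[_] : ∀ n → (Fin n → Carrier) → Carrier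
  Σ[ zero  ] f = 0#
  Σ[ suc n ] f = f zero + Σ[ n ] (λ i → f (suc i))

  Matrix : ℕ → Set
  Matrix n = Fin n → Fin n → Carrier

  IsEigenvalue : ∀ {n} → Matrix n → Carrier → Set
  IsEigenvalue {n} A t =
    Σ (Fin n → Carrier) λ v → (∃ λ i → ¬ (v i ≈ 0#)) ×
      (∀ i → Σ[ n ] (λ j → A i j * v j) ≈ (t * v i))

  IsLeastEigenvalue : ∀ {n} → Matrix n → Carrier → Set
  IsLeastEigenvalue A t = IsEigenvalue A t × (∀ s → IsEigenvalue A s → t ≤ s)

record Graph (n : ℕ) : Set where
  field
    adj     : Fin n → Fin n → Bool
    adj-sym : ∀ x y → adj x y ≡ adj y x
    irrefl  : ∀ x → adj x x ≡ false
open Graph public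

count : ∀ {n} → (Fin n → Bool) → ℕ
count {zero}  P = 0
count {suc n} P = (if P zero then 1 else 0) Data.Nat.+ count (λ i → P (suc i))

record IsSRG {n : ℕ} (G : Graph n) (k l m : ℕ) : Set where
  field
    regular  : ∀ x → count (adj G x) ≡ k
    adjacent : ∀ x y → x ≢ y → adj G x y ≡ true →
               count (λ z → adj G x z ∧ adj G y z) ≡ l
    nonadj   : ∀ x y → x ≢ y → adj G x y ≡ false →
               count (λ z → adj G x z ∧ adj G y z) ≡ m

complement : ∀ {n} → Graph n → Graph n
complement {n} G = record
  { adj     = cadj
  ; adj-sym = csym
  ; irrefl  = cirr
  }
  where
  cadj : Fin n → Fin n → Bool
  cadj x y = if does (x ≟ y) then false else not (adj G x y)
  csym : ∀ x y → cadj x y ≡ cadj y x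
  csym x y with x ≟ y | y ≟ x
  ... | yes _ | yes _ = refl
  ... | yes p | no q = ⊥-elim (q (sym p))
  ... | no p | yes q = ⊥-elim (p (sym q))
  ... | no _ | no _ = cong not (adj-sym G x y)
  cirr : ∀ x → cadj x x ≡ false
  cirr x with x ≟ x
  ... | yes _ = refl
  ... | no p = ⊥-elim (p refl)

data Reach {n} (G : Graph n) (x : Fin n) : Fin n → Set where
  here : Reach G x x
  step : ∀ {y z} → Reach G x y → adj G y z ≡ true → Reach G x z

Connected : ∀ {n} → Graph n → Set
Connected {n} G = ∀ (x y : Fin n) → Reach G x y

Primitive : ∀ {n} → Graph n → Set
Primitive G = Connected G × Connected (complement G)

IsHomomorphism : ∀ {m n} → Graph m → Graph n → (Fin m → Fin n) → Set
IsHomomorphism G H φ = ∀ u v → adj G u v ≡ true → adj H (φ u) (φ v) ≡ true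

module _ (R : RealField) where
  open RealField R

  adjacencyMatrix : ∀ {n} → Graph n → Matrix n
  adjacencyMatrix G x y = if adj G x y then 1# else 0#

  identityMatrix : ∀ {n} → Matrix n
  identityMatrix x y = if does (x ≟ y) then 1# else 0#

  adjacencyCosine : (k : ℕ) (τ : Carrier) → Carrier
  adjacencyCosine k τ = τ * (ι k ⁻¹)

  nonAdjacencyCosine : (n k : ℕ) (τ : Carrier) → Carrier
  nonAdjacencyCosine n k τ = (- τ - 1#) * ((ι n - ι k - 1#) ⁻¹)

  cosineMatrix : ∀ {n} → Graph n → (k : ℕ) (τ : Carrier) → Matrix n
  cosineMatrix {n} H k τ x y =
    if does (x ≟ y) then 1#
    else (if adj H x y then adjacencyCosine k τ else nonAdjacencyCosine n k τ)

  pullback : ∀ {m n} → Matrix n → (Fin m → Fin n) → Matrix m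
  pullback E φ u v = E (φ u) (φ v)

  _⊗_ : ∀ {n} → Matrix n → Matrix n → Matrix n
  _⊗_ {n} A B x y = Σ[ n ] (λ z → A x z * B z y)

  _⊖_ : ∀ {n} → Matrix n → Matrix n → Matrix n
  (A ⊖ B) x y = A x y - B x y

  scale : ∀ {n} → Carrier → Matrix n → Matrix n
  scale c A x y = c * A x y

  IsZeroMatrix : ∀ {n} → Matrix n → Set
  IsZeroMatrix M = ∀ x y → M x y ≈ 0#

-- The least eigenvalue τ of a primitive strongly regular graph is the smaller root of
-- t² - (λ - μ) t - (k - μ); let θ be the other one.  For either root a, with b the other one and
-- c = (k - a) / n, the matrix Π = A - a I - c J satisfies Π² = (b - a) Π.  Taking a = τ, the form
-- ⟨ v , (A - τ I) v ⟩ = ⟨ v , Π v ⟩ + c (Σ v)² is non-negative.  Taking a = θ for H, Π is a nonzero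
-- multiple of E_H, so E_H^φ is a nonzero multiple of the Gram matrix W Wᵀ of the rows of Π pulled back
-- along φ.  Since φ maps edges to edges and the adjacency cosines agree, each diagonal entry of
-- (A - τ I) E_H^φ is k (τ / k) - τ = 0.  So the trace of (A - τ I) W Wᵀ, the sum of the non-negative
-- terms ⟨ w , (A - τ I) w ⟩ over the columns w of W, vanishes; hence (A - τ I) w = 0 for each column,
-- and (A - τ I) E_H^φ = 0.

module Submission where

open import Defs
open import Data.Nat as ℕ using (ℕ; zero; suc)
open import Data.Integer as ℤ using (ℤ; +_; -[1+_])
import Data.Integer.Properties as ℤ
open import Data.Fin as Fin using (Fin; zero; suc)
open import Data.Bool using (Bool; true; false; if_then_else_; _∧_; not)
open import Data.Bool.Properties using (∧-idem)
open import Data.Maybe using (Maybe; just; nothing)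
open import Data.Product using (Σ; _×_; _,_; proj₁; proj₂)
open import Data.Sum using (_⊎_; inj₁; inj₂)
open import Data.Empty using (⊥-elim)
open import Relation.Nullary using (¬_; Dec; yes; no)
open import Relation.Nullary.Decidable using (dec-true; dec-false)
open import Relation.Binary.PropositionalEquality as ≡ using (_≡_; _≢_)
open import Relation.Binary.Structures using (IsTotalOrder)
open import Algebra.Solver.Ring.AlmostCommutativeRing
  using (_-Raw-AlmostCommutative⟶_; fromCommutativeRing)
import Algebra.Solver.Ring as RingSolver
import Algebra.Properties.Ring as RingProperties
import Relation.Binary.Reasoning.Setoid as SetoidReasoning

adj⇒≢ : ∀ {n} (G : Graph n) {x y} → adj G x y ≡ true → x ≢ y
adj⇒≢ G {x} x~y ≡.refl with ≡.trans (≡.sym x~y) (irrefl G x)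
... | ()

has-neighbour : ∀ {n} {G : Graph n} → Connected G → ∀ {x y} → x ≢ y → Σ (Fin n) λ z → adj G x z ≡ true
has-neighbour {G = G} connected {x} {y} x≢y = last-edge (connected y x)
  where
  last-edge : Reach G y x → Σ _ λ z → adj G x z ≡ true
  last-edge here             = ⊥-elim (x≢y ≡.refl)
  last-edge (step {z} _ z~x) = z , ≡.trans (adj-sym G x z) z~x

has-non-neighbour : ∀ {n} {G : Graph n} → Connected (complement G) → ∀ {x y} → x ≢ y →
                    Σ (Fin n) λ w → w ≢ x × adj G x w ≡ false
has-non-neighbour {G = G} connected {x} {y} x≢y = non-adjacent (has-neighbour connected x≢y)
  where
  non-adjacent : (Σ _ λ w → adj (complement G) x w ≡ true) → Σ _ λ w → w ≢ x × adj G x w ≡ false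
  non-adjacent (w , x~ᶜw) with x Fin.≟ w
  ... | no x≢w = w , (λ w≡x → x≢w (≡.sym w≡x)) , not-true x~ᶜw
    where
    not-true : ∀ {b} → not b ≡ true → b ≡ false
    not-true {false} _ = ≡.refl

module _ (R : RealField) where
  open RealField R hiding (_≤_)
  open RingProperties ring using (-‿distribˡ-*; -‿distribʳ-*; -‿involutive; -0#≈0#; -‿+-comm)
  open SetoidReasoning setoid

  ι-+ : ∀ m n → ι (m ℕ.+ n) ≈ ι m + ι n
  ι-+ zero    n = sym (+-identityˡ _)
  ι-+ (suc m) n = trans (+-congˡ (ι-+ m n)) (sym (+-assoc _ _ _))

  ι-* : ∀ m n → ι (m ℕ.* n) ≈ ι m * ι n
  ι-* zero    n = sym (zeroˡ _)
  ι-* (suc m) n = begin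
    ι (n ℕ.+ m ℕ.* n)     ≈⟨ ι-+ n (m ℕ.* n) ⟩
    ι n + ι (m ℕ.* n)     ≈⟨ +-cong (sym (*-identityˡ _)) (ι-* m n) ⟩
    1# * ι n + ι m * ι n  ≈⟨ sym (distribʳ _ _ _) ⟩
    (1# + ι m) * ι n      ∎

  private
    ⟦_⟧ι : ℤ → Carrier
    ⟦ + n      ⟧ι = ι n
    ⟦ -[1+ n ] ⟧ι = - ι (suc n)

    ⟦-⟧ι : ∀ i → ⟦ ℤ.- i ⟧ι ≈ - ⟦ i ⟧ι
    ⟦-⟧ι (+ zero)  = sym -0#≈0#
    ⟦-⟧ι (+ suc n) = refl
    ⟦-⟧ι -[1+ n ]  = sym (-‿involutive _)

    ι-1+-cancel : ∀ m n → ι m - ι n ≈ ι (suc m) - ι (suc n)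
    ι-1+-cancel m n = begin
      ι m + - ι n                    ≈⟨ sym (+-identityˡ _) ⟩
      0# + (ι m + - ι n)             ≈⟨ +-congʳ (sym (-‿inverseʳ 1#)) ⟩
      (1# + - 1#) + (ι m + - ι n)    ≈⟨ +-assoc _ _ _ ⟩
      1# + (- 1# + (ι m + - ι n))    ≈⟨ +-congˡ (sym (+-assoc _ _ _)) ⟩
      1# + ((- 1# + ι m) + - ι n)    ≈⟨ +-congˡ (+-congʳ (+-comm _ _)) ⟩
      1# + ((ι m + - 1#) + - ι n)    ≈⟨ +-congˡ (+-assoc _ _ _) ⟩
      1# + (ι m + (- 1# + - ι n))    ≈⟨ sym (+-assoc _ _ _) ⟩
      (1# + ι m) + (- 1# + - ι n)    ≈⟨ +-congˡ (-‿+-comm _ _) ⟩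
      (1# + ι m) + - (1# + ι n)      ∎

    ⟦⊖⟧ι : ∀ m n → ⟦ m ℤ.⊖ n ⟧ι ≈ ι m - ι n
    ⟦⊖⟧ι m       zero    = sym (trans (+-congˡ -0#≈0#) (+-identityʳ _))
    ⟦⊖⟧ι zero    (suc n) = sym (+-identityˡ _)
    ⟦⊖⟧ι (suc m) (suc n) = begin
      ⟦ suc m ℤ.⊖ suc n ⟧ι  ≡⟨ ≡.cong ⟦_⟧ι (ℤ.[1+m]⊖[1+n]≡m⊖n m n) ⟩
      ⟦ m ℤ.⊖ n ⟧ι          ≈⟨ ⟦⊖⟧ι m n ⟩
      ι m - ι n             ≈⟨ ι-1+-cancel m n ⟩
      ι (suc m) - ι (suc n) ∎

    ⟦+⟧ι : ∀ i j → ⟦ i ℤ.+ j ⟧ι ≈ ⟦ i ⟧ι + ⟦ j ⟧ι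
    ⟦+⟧ι (+ m)    (+ n)    = ι-+ m n
    ⟦+⟧ι (+ m)    -[1+ n ] = ⟦⊖⟧ι m (suc n)
    ⟦+⟧ι -[1+ m ] (+ n)    = trans (⟦⊖⟧ι n (suc m)) (+-comm _ _)
    ⟦+⟧ι -[1+ m ] -[1+ n ] = begin
      - (1# + ι (suc (m ℕ.+ n)))  ≈⟨ -‿cong (+-congˡ (ι-+ (suc m) n)) ⟩
      - (1# + (ι (suc m) + ι n))  ≈⟨ -‿cong (trans (sym (+-assoc _ _ _)) (trans (+-congʳ (+-comm _ _)) (+-assoc _ _ _))) ⟩
      - (ι (suc m) + (1# + ι n))  ≈⟨ sym (-‿+-comm _ _) ⟩
      - ι (suc m) + - ι (suc n)   ∎

    ⟦+*+⟧ι : ∀ m n → ⟦ + m ℤ.* + n ⟧ι ≈ ι m * ι n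
    ⟦+*+⟧ι m n = trans (reflexive (≡.cong ⟦_⟧ι (≡.sym (ℤ.pos-* m n)))) (ι-* m n)

    ⟦*⟧ι : ∀ i j → ⟦ i ℤ.* j ⟧ι ≈ ⟦ i ⟧ι * ⟦ j ⟧ι
    ⟦*⟧ι (+ m) (+ n) = ⟦+*+⟧ι m n
    ⟦*⟧ι (+ m) -[1+ n ] = begin
      ⟦ + m ℤ.* ℤ.- (+ suc n) ⟧ι  ≡⟨ ≡.cong ⟦_⟧ι (≡.sym (ℤ.neg-distribʳ-* (+ m) (+ suc n))) ⟩
      ⟦ ℤ.- (+ m ℤ.* + suc n) ⟧ι  ≈⟨ ⟦-⟧ι (+ m ℤ.* + suc n) ⟩
      - ⟦ + m ℤ.* + suc n ⟧ι      ≈⟨ -‿cong (⟦+*+⟧ι m (suc n)) ⟩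
      - (ι m * ι (suc n))         ≈⟨ -‿distribʳ-* _ _ ⟩
      ι m * - ι (suc n)           ∎
    ⟦*⟧ι -[1+ m ] (+ n) = begin
      ⟦ ℤ.- (+ suc m) ℤ.* + n ⟧ι  ≡⟨ ≡.cong ⟦_⟧ι (≡.sym (ℤ.neg-distribˡ-* (+ suc m) (+ n))) ⟩
      ⟦ ℤ.- (+ suc m ℤ.* + n) ⟧ι  ≈⟨ ⟦-⟧ι (+ suc m ℤ.* + n) ⟩
      - ⟦ + suc m ℤ.* + n ⟧ι      ≈⟨ -‿cong (⟦+*+⟧ι (suc m) n) ⟩
      - (ι (suc m) * ι n)         ≈⟨ -‿distribˡ-* _ _ ⟩
      - ι (suc m) * ι n           ∎
    ⟦*⟧ι -[1+ m ] -[1+ n ] = begin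
      ⟦ + suc m ℤ.* + suc n ⟧ι    ≈⟨ ⟦+*+⟧ι (suc m) (suc n) ⟩
      ι (suc m) * ι (suc n)       ≈⟨ sym (-‿involutive _) ⟩
      - - (ι (suc m) * ι (suc n)) ≈⟨ -‿cong (-‿distribˡ-* _ _) ⟩
      - (- ι (suc m) * ι (suc n)) ≈⟨ -‿distribʳ-* _ _ ⟩
      - ι (suc m) * - ι (suc n)   ∎

  -- The solver's constant 1 must be 1# on the nose, which ι 1 = 1# + 0# is not.
  ι′ : ℕ → Carrier
  ι′ zero          = 0#
  ι′ (suc zero)    = 1#
  ι′ (suc (suc n)) = 1# + ι′ (suc n)

  ι′≈ι : ∀ n → ι′ n ≈ ι n
  ι′≈ι zero          = refl
  ι′≈ι (suc zero)    = sym (+-identityʳ 1#)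
  ι′≈ι (suc (suc n)) = +-congˡ (ι′≈ι (suc n))

  ⟦_⟧ℤ : ℤ → Carrier
  ⟦ + n      ⟧ℤ = ι′ n
  ⟦ -[1+ n ] ⟧ℤ = - ι′ (suc n)

  ⟦⟧ℤ≈⟦⟧ι : ∀ i → ⟦ i ⟧ℤ ≈ ⟦ i ⟧ι
  ⟦⟧ℤ≈⟦⟧ι (+ n)    = ι′≈ι n
  ⟦⟧ℤ≈⟦⟧ι -[1+ n ] = -‿cong (ι′≈ι (suc n))

  ℤ-morphism : ℤ.+-*-rawRing -Raw-AlmostCommutative⟶ fromCommutativeRing commutativeRing
  ℤ-morphism = record
    { ⟦_⟧    = ⟦_⟧ℤ
    ; +-homo = λ i j → transport (⟦+⟧ι i j) (⟦⟧ℤ≈⟦⟧ι (i ℤ.+ j)) (+-cong (⟦⟧ℤ≈⟦⟧ι i) (⟦⟧ℤ≈⟦⟧ι j))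
    ; *-homo = λ i j → transport (⟦*⟧ι i j) (⟦⟧ℤ≈⟦⟧ι (i ℤ.* j)) (*-cong (⟦⟧ℤ≈⟦⟧ι i) (⟦⟧ℤ≈⟦⟧ι j))
    ; -‿homo = λ i → transport (⟦-⟧ι i) (⟦⟧ℤ≈⟦⟧ι (ℤ.- i)) (-‿cong (⟦⟧ℤ≈⟦⟧ι i))
    ; 0-homo = refl
    ; 1-homo = refl
    }
    where
    transport : ∀ {a b a′ b′} → a ≈ b → a′ ≈ a → b′ ≈ b → a′ ≈ b′
    transport a≈b a′≈a b′≈b = trans a′≈a (trans a≈b (sym b′≈b))

  ⟦⟧ℤ-≟ : ∀ i j → Maybe (⟦ i ⟧ℤ ≈ ⟦ j ⟧ℤ)
  ⟦⟧ℤ-≟ i j with i ℤ.≟ j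
  ... | yes ≡.refl = just refl
  ... | no _       = nothing

  open RingSolver ℤ.+-*-rawRing (fromCommutativeRing commutativeRing) ℤ-morphism ⟦⟧ℤ-≟

  :0 :1 : ∀ {n} → Polynomial n
  :0 = con (+ 0)
  :1 = con (+ 1)

  -- The field's _≤_ carries no fixity declaration.
  infix 4 _≤_
  _≤_ : Carrier → Carrier → Set
  _≤_ = RealField._≤_ R

  module ≤ = IsTotalOrder isTotalOrder

  ≤-resp-≈ : ∀ {a a′ b b′} → a ≈ a′ → b ≈ b′ → a ≤ b → a′ ≤ b′
  ≤-resp-≈ p q r = ≤.trans (≤.reflexive (sym p)) (≤.trans r (≤.reflexive q))

  nonneg-resp-≈ : ∀ {a b} → a ≈ b → 0# ≤ a → 0# ≤ b
  nonneg-resp-≈ = ≤-resp-≈ refl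

  x≤y⇒0≤y-x : ∀ {x y} → x ≤ y → 0# ≤ y - x
  x≤y⇒0≤y-x {x} p = ≤-resp-≈ (-‿inverseʳ x) refl (+-monoˡ-≤ (- x) p)

  0≤y-x⇒x≤y : ∀ {x y} → 0# ≤ y - x → x ≤ y
  0≤y-x⇒x≤y {x} {y} p = ≤-resp-≈ (+-identityˡ x) (solve 2 (λ x y → (y :- x) :+ x := y) refl x y) (+-monoˡ-≤ x p)

  +-nonneg : ∀ {x y} → 0# ≤ x → 0# ≤ y → 0# ≤ x + y
  +-nonneg {x} {y} p q = ≤.trans q (≤-resp-≈ (+-identityˡ y) refl (+-monoˡ-≤ y p))

  +-mono-≤ : ∀ {a b c d} → a ≤ b → c ≤ d → a + c ≤ b + d
  +-mono-≤ {a} {b} {c} {d} p q = 0≤y-x⇒x≤y (nonneg-resp-≈ eq (+-nonneg (x≤y⇒0≤y-x p) (x≤y⇒0≤y-x q)))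
    where
    eq : (b - a) + (d - c) ≈ (b + d) - (a + c)
    eq = solve 4 (λ a b c d → (b :- a) :+ (d :- c) := (b :+ d) :- (a :+ c)) refl a b c d

  x≤0⇒0≤-x : ∀ {x} → x ≤ 0# → 0# ≤ - x
  x≤0⇒0≤-x {x} p = nonneg-resp-≈ (solve 1 (λ x → :0 :- x := :- x) refl x) (x≤y⇒0≤y-x p)

  0≤-x⇒x≤0 : ∀ {x} → 0# ≤ - x → x ≤ 0#
  0≤-x⇒x≤0 {x} p = 0≤y-x⇒x≤y (nonneg-resp-≈ (solve 1 (λ x → :- x := :0 :- x) refl x) p)

  square-nonneg : ∀ x → 0# ≤ x * x
  square-nonneg x with ≤.total 0# x
  ... | inj₁ p = *-nonneg p p
  ... | inj₂ p = nonneg-resp-≈ (solve 1 (λ x → (:- x) :* (:- x) := x :* x) refl x)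
                               (*-nonneg (x≤0⇒0≤-x p) (x≤0⇒0≤-x p))

  0≤1 : 0# ≤ 1#
  0≤1 = nonneg-resp-≈ (*-identityˡ 1#) (square-nonneg 1#)

  ι-nonneg : ∀ n → 0# ≤ ι n
  ι-nonneg zero    = ≤.refl
  ι-nonneg (suc n) = +-nonneg 0≤1 (ι-nonneg n)

  1≰0 : ¬ (1# ≤ 0#)
  1≰0 p = 0≉1 (≤.antisym 0≤1 p)

  *-monoˡ-≤-nonneg : ∀ {c a b} → 0# ≤ c → a ≤ b → c * a ≤ c * b
  *-monoˡ-≤-nonneg {c} {a} {b} 0≤c p = 0≤y-x⇒x≤y
    (nonneg-resp-≈ (solve 3 (λ c a b → c :* (b :- a) := c :* b :- c :* a) refl c a b) (*-nonneg 0≤c (x≤y⇒0≤y-x p)))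

  Positive : Carrier → Set
  Positive x = 0# ≤ x × ¬ (x ≈ 0#)

  1≤⇒positive : ∀ {x} → 1# ≤ x → Positive x
  1≤⇒positive p = ≤.trans 0≤1 p , λ x≈0 → 1≰0 (≤-resp-≈ refl x≈0 p)

  ⁻¹-inverseˡ : ∀ {x} → ¬ (x ≈ 0#) → x ⁻¹ * x ≈ 1#
  ⁻¹-inverseˡ {x} x≉0 = trans (*-comm _ _) (⁻¹-inverse x x≉0)

  x*y≈0⇒y≈0 : ∀ {x y} → ¬ (x ≈ 0#) → x * y ≈ 0# → y ≈ 0#
  x*y≈0⇒y≈0 {x} {y} x≉0 xy≈0 = begin
    y              ≈⟨ sym (*-identityˡ y) ⟩
    1# * y         ≈⟨ *-congʳ (sym (⁻¹-inverseˡ x≉0)) ⟩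
    (x ⁻¹ * x) * y ≈⟨ *-assoc _ _ _ ⟩
    x ⁻¹ * (x * y) ≈⟨ *-congˡ xy≈0 ⟩
    x ⁻¹ * 0#      ≈⟨ zeroʳ _ ⟩
    0#             ∎

  ⁻¹-positive : ∀ {x} → Positive x → Positive (x ⁻¹)
  ⁻¹-positive {x} (0≤x , x≉0) = 0≤x⁻¹ , x⁻¹≉0
    where
    x⁻¹≉0 : ¬ (x ⁻¹ ≈ 0#)
    x⁻¹≉0 e = 0≉1 (trans (sym (trans (*-congˡ e) (zeroʳ x))) (⁻¹-inverse x x≉0))
    0≤x⁻¹ : 0# ≤ x ⁻¹
    0≤x⁻¹ with ≤.total 0# (x ⁻¹)
    ... | inj₁ p = p
    ... | inj₂ p = ⊥-elim (1≰0 (0≤-x⇒x≤0 (nonneg-resp-≈ eq (*-nonneg 0≤x (x≤0⇒0≤-x p)))))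
      where
      eq : x * - (x ⁻¹) ≈ - 1#
      eq = trans (sym (-‿distribʳ-* _ _)) (-‿cong (⁻¹-inverse x x≉0))

  nonneg-*-cancelˡ : ∀ {a q} → Positive a → 0# ≤ a * q → 0# ≤ q
  nonneg-*-cancelˡ {a} {q} (0≤a , a≉0) p with ≤.total 0# q
  ... | inj₁ r = r
  ... | inj₂ r = ≤.reflexive (sym (x*y≈0⇒y≈0 a≉0 aq≈0))
    where
    aq≈0 : a * q ≈ 0#
    aq≈0 = ≤.antisym (0≤-x⇒x≤0 (nonneg-resp-≈ (sym (-‿distribʳ-* a q)) (*-nonneg 0≤a (x≤0⇒0≤-x r)))) p

  -- The supremum s of the multiples of x is also bounded by s - x.
  archimedean : ∀ {x} c → 0# ≤ x → (∀ n → ι n * x ≤ c) → x ≈ 0#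
  archimedean {x} c 0≤x bounded = ≤.antisym x≤0 0≤x
    where
    Multiple : Carrier → Set
    Multiple t = Σ ℕ λ n → t ≈ ι n * x
    sup : Σ Carrier λ s → (∀ t → Multiple t → t ≤ s) × (∀ b → (∀ t → Multiple t → t ≤ b) → s ≤ b)
    sup = lub Multiple (0# , 0 , sym (zeroˡ x)) (c , λ t (n , t≈) → ≤-resp-≈ (sym t≈) refl (bounded n))
    s : Carrier
    s = proj₁ sup
    s-x-upper : ∀ t → Multiple t → t ≤ s - x
    s-x-upper t (n , t≈) = ≤-resp-≈ eq refl (+-monoˡ-≤ (- x) (proj₁ (proj₂ sup) _ (suc n , refl)))
      where
      eq : ι (suc n) * x - x ≈ t
      eq = trans (solve 2 (λ a x → (:1 :+ a) :* x :- x := a :* x) refl (ι n) x) (sym t≈)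
    x≤0 : x ≤ 0#
    x≤0 = 0≤y-x⇒x≤y (nonneg-resp-≈ (solve 2 (λ s x → (s :- x) :- s := :0 :- x) refl s x)
                                    (x≤y⇒0≤y-x (proj₂ (proj₂ sup) _ s-x-upper)))

  private
    square≤1⇒≤1 : ∀ {y} → 0# ≤ y → y * y ≤ 1# → y ≤ 1#
    square≤1⇒≤1 {y} 0≤y p with ≤.total y 1#
    ... | inj₁ q = q
    ... | inj₂ q = ≤.trans (≤-resp-≈ (*-identityʳ y) refl (*-monoˡ-≤-nonneg 0≤y q)) p

    nonneg-square≈0⇒≈0 : ∀ {x} → 0# ≤ x → x * x ≈ 0# → x ≈ 0#
    nonneg-square≈0⇒≈0 {x} 0≤x xx≈0 = archimedean 1# 0≤x bounded
      where
      bounded : ∀ n → ι n * x ≤ 1#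
      bounded n = square≤1⇒≤1 (*-nonneg (ι-nonneg n) 0≤x) (≤.trans (≤.reflexive square≈0) 0≤1)
        where
        square≈0 : (ι n * x) * (ι n * x) ≈ 0#
        square≈0 = trans (solve 2 (λ a x → (a :* x) :* (a :* x) := (a :* a) :* (x :* x)) refl (ι n) x)
                         (trans (*-congˡ xx≈0) (zeroʳ _))

  square≈0⇒≈0 : ∀ {x} → x * x ≈ 0# → x ≈ 0#
  square≈0⇒≈0 {x} xx≈0 with ≤.total 0# x
  ... | inj₁ p = nonneg-square≈0⇒≈0 p xx≈0
  ... | inj₂ p = trans (sym (-‿involutive x)) (trans (-‿cong (nonneg-square≈0⇒≈0 (x≤0⇒0≤-x p) eq)) -0#≈0#)
    where
    eq : (- x) * (- x) ≈ 0#
    eq = trans (solve 1 (λ x → (:- x) :* (:- x) := x :* x) refl x) xx≈0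

  square-≤⇒≤ : ∀ {x b} → 0# ≤ x → 0# ≤ b → x * x ≤ b * b → x ≤ b
  square-≤⇒≤ {x} {b} 0≤x 0≤b p with ≤.total x b
  ... | inj₁ q = q
  ... | inj₂ q = ≤.reflexive x≈b
    where
    t : Carrier
    t = x - b
    tt≈0 : t * t ≈ 0#
    tt≈0 = ≤.antisym (≤.trans (*-monoˡ-≤-nonneg (x≤y⇒0≤y-x q) t≤x+b) (0≤-x⇒x≤0 eq)) (square-nonneg t)
      where
      t≤x+b : t ≤ x + b
      t≤x+b = 0≤y-x⇒x≤y (nonneg-resp-≈ (solve 2 (λ x b → b :+ b := (x :+ b) :- (x :- b)) refl x b) (+-nonneg 0≤b 0≤b))
      eq : 0# ≤ - (t * (x + b))
      eq = nonneg-resp-≈ (solve 2 (λ x b → b :* b :- x :* x := :- ((x :- b) :* (x :+ b))) refl x b) (x≤y⇒0≤y-x p)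
    x≈b : x ≈ b
    x≈b = trans (solve 2 (λ x b → x := (x :- b) :+ b) refl x b) (trans (+-congʳ (square≈0⇒≈0 tt≈0)) (+-identityˡ b))

  module SquareRoot {D} (0≤D : 0# ≤ D) where
    Below : Carrier → Set
    Below x = 0# ≤ x × x * x ≤ D

    below-0 : Below 0#
    below-0 = ≤.refl , ≤.trans (≤.reflexive (zeroˡ 0#)) 0≤D

    below-bounded : ∀ x → Below x → x ≤ D + 1#
    below-bounded x (0≤x , xx≤D) with ≤.total x (D + 1#)
    ... | inj₁ q = q
    ... | inj₂ q = ⊥-elim (1≰0 (0≤-x⇒x≤0 (nonneg-resp-≈ eq (+-nonneg (x≤y⇒0≤y-x too-big) (+-nonneg (square-nonneg D) 0≤D)))))
      where
      too-big : (D + 1#) * (D + 1#) ≤ D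
      too-big = ≤.trans (*-monoˡ-≤-nonneg (+-nonneg 0≤D 0≤1) q)
                        (≤.trans (≤-resp-≈ (*-comm _ _) (*-comm _ _) (*-monoˡ-≤-nonneg 0≤x q)) xx≤D)
      eq : (D - (D + 1#) * (D + 1#)) + (D * D + D) ≈ - 1#
      eq = solve 1 (λ D → (D :- (D :+ :1) :* (D :+ :1)) :+ (D :* D :+ D) := :- :1) refl D

    private
      sup : Σ Carrier λ s → (∀ x → Below x → x ≤ s) × (∀ b → (∀ x → Below x → x ≤ b) → s ≤ b)
      sup = lub Below (0# , below-0) (D + 1# , below-bounded)

    s : Carrier
    s = proj₁ sup

    s-upper : ∀ x → Below x → x ≤ s
    s-upper = proj₁ (proj₂ sup)

    s-least : ∀ b → (∀ x → Below x → x ≤ b) → s ≤ b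
    s-least = proj₂ (proj₂ sup)

    0≤s : 0# ≤ s
    0≤s = s-upper 0# below-0

    ε≈0 : ∀ {ε} → 0# ≤ ε → s + ε ≤ s → ε ≈ 0#
    ε≈0 {ε} 0≤ε p = ≤.antisym (0≤y-x⇒x≤y (nonneg-resp-≈ (solve 2 (λ s ε → s :- (s :+ ε) := :0 :- ε) refl s ε) (x≤y⇒0≤y-x p))) 0≤ε

    -- If s * s < D, then s + ε is still Below for ε = (D - s * s) / (2 s + 1 + D - s * s).
    D≤s*s : D ≤ s * s
    D≤s*s with ≤.total (s * s) D
    ... | inj₂ q = q
    ... | inj₁ q = ≤.reflexive (sym ss≈D)
      where
      e d ε : Carrier
      e = D - s * s
      d = (s + s + 1#) + e
      ε = e * d ⁻¹
      0≤e : 0# ≤ e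
      0≤e = x≤y⇒0≤y-x q
      d-pos : Positive d
      d-pos = 1≤⇒positive (0≤y-x⇒x≤y (nonneg-resp-≈ (solve 2 (λ s e → s :+ s :+ e := ((s :+ s :+ :1) :+ e) :- :1) refl s e) (+-nonneg (+-nonneg 0≤s 0≤s) 0≤e)))
      0≤ε : 0# ≤ ε
      0≤ε = *-nonneg 0≤e (proj₁ (⁻¹-positive d-pos))
      εd≈e : ε * d ≈ e
      εd≈e = trans (*-assoc _ _ _) (trans (*-congˡ (⁻¹-inverseˡ (proj₂ d-pos))) (*-identityʳ e))
      0≤1-ε : 0# ≤ 1# - ε
      0≤1-ε = nonneg-*-cancelˡ d-pos (nonneg-resp-≈ eq (+-nonneg (+-nonneg 0≤s 0≤s) 0≤1))
        where
        eq : s + s + 1# ≈ d * (1# - ε)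
        eq = trans (solve 3 (λ s e ε → s :+ s :+ :1 := ((s :+ s :+ :1) :+ e) :* (:1 :- ε) :+ (ε :* ((s :+ s :+ :1) :+ e) :- e)) refl s e ε)
                   (trans (+-congˡ (trans (+-congʳ εd≈e) (-‿inverseʳ e))) (+-identityʳ _))
      s+ε-below : Below (s + ε)
      s+ε-below = +-nonneg 0≤s 0≤ε , 0≤y-x⇒x≤y (nonneg-resp-≈ eq (*-nonneg 0≤ε (+-nonneg 0≤1-ε 0≤e)))
        where
        eq : ε * ((1# - ε) + e) ≈ D - (s + ε) * (s + ε)
        eq = begin
          ε * ((1# - ε) + e)
            ≈⟨ solve 4 (λ s e ε D → ε :* ((:1 :- ε) :+ e) := (ε :* ((s :+ s :+ :1) :+ e) :- (s :* s :+ s :* ε :+ s :* ε :+ ε :* ε)) :+ (s :* s)) refl s e ε D ⟩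
          (ε * d - (s * s + s * ε + s * ε + ε * ε)) + s * s
            ≈⟨ +-congʳ (+-congʳ εd≈e) ⟩
          (e - (s * s + s * ε + s * ε + ε * ε)) + s * s
            ≈⟨ solve 3 (λ s ε D → ((D :- s :* s) :- (s :* s :+ s :* ε :+ s :* ε :+ ε :* ε)) :+ s :* s := D :- (s :+ ε) :* (s :+ ε)) refl s ε D ⟩
          D - (s + ε) * (s + ε) ∎
      ss≈D : s * s ≈ D
      ss≈D = begin
        s * s   ≈⟨ solve 2 (λ s D → s :* s := D :- (D :- s :* s)) refl s D ⟩
        D - e   ≈⟨ +-congˡ (-‿cong (trans (sym εd≈e) (trans (*-congʳ (ε≈0 0≤ε (s-upper _ s+ε-below))) (zeroˡ _)))) ⟩
        D - 0#  ≈⟨ trans (+-congˡ -0#≈0#) (+-identityʳ D) ⟩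
        D       ∎

    -- If s * s > D, then s - ε is still an upper bound for ε = (s * s - D) / (2 s + 1).
    s*s≤D : s * s ≤ D
    s*s≤D with ≤.total (s * s) D
    ... | inj₁ q = q
    ... | inj₂ q = ≤.reflexive ss≈D
      where
      e d ε b : Carrier
      e = s * s - D
      d = s + s + 1#
      ε = e * d ⁻¹
      b = s - ε
      0≤e : 0# ≤ e
      0≤e = x≤y⇒0≤y-x q
      d-pos : Positive d
      d-pos = 1≤⇒positive (0≤y-x⇒x≤y (nonneg-resp-≈ (solve 1 (λ s → s :+ s := (s :+ s :+ :1) :- :1) refl s) (+-nonneg 0≤s 0≤s)))
      0≤ε : 0# ≤ ε
      0≤ε = *-nonneg 0≤e (proj₁ (⁻¹-positive d-pos))
      εd≈e : ε * d ≈ e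
      εd≈e = trans (*-assoc _ _ _) (trans (*-congˡ (⁻¹-inverseˡ (proj₂ d-pos))) (*-identityʳ e))
      0≤b : 0# ≤ b
      0≤b = nonneg-*-cancelˡ d-pos (nonneg-resp-≈ eq (+-nonneg (+-nonneg (square-nonneg s) 0≤s) 0≤D))
        where
        eq : s * s + s + D ≈ d * b
        eq = trans (solve 3 (λ s ε D → s :* s :+ s :+ D := (s :+ s :+ :1) :* (s :- ε) :+ (ε :* (s :+ s :+ :1) :- (s :* s :- D))) refl s ε D)
                   (trans (+-congˡ (trans (+-congʳ εd≈e) (-‿inverseʳ e))) (+-identityʳ _))
      D≤bb : D ≤ b * b
      D≤bb = 0≤y-x⇒x≤y (nonneg-resp-≈ eq (+-nonneg 0≤ε (square-nonneg ε)))
        where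
        eq : ε + ε * ε ≈ b * b - D
        eq = begin
          ε + ε * ε
            ≈⟨ solve 3 (λ s ε D → ε :+ ε :* ε := ((s :- ε) :* (s :- ε) :- D) :+ (ε :* (s :+ s :+ :1) :- (s :* s :- D))) refl s ε D ⟩
          (b * b - D) + (ε * d - e) ≈⟨ +-congˡ (trans (+-congʳ εd≈e) (-‿inverseʳ e)) ⟩
          (b * b - D) + 0#          ≈⟨ +-identityʳ _ ⟩
          b * b - D                 ∎
      s+ε≤s : s + ε ≤ s
      s+ε≤s = ≤-resp-≈ refl (solve 2 (λ s ε → s :- ε :+ ε := s) refl s ε)
                (+-monoˡ-≤ ε (s-least b (λ x (0≤x , xx≤D) → square-≤⇒≤ 0≤x 0≤b (≤.trans xx≤D D≤bb))))
      ss≈D : s * s ≈ D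
      ss≈D = begin
        s * s        ≈⟨ solve 2 (λ s D → s :* s := D :+ (s :* s :- D)) refl s D ⟩
        D + e        ≈⟨ +-congˡ (trans (sym εd≈e) (trans (*-congʳ (ε≈0 0≤ε s+ε≤s)) (zeroˡ _))) ⟩
        D + 0#       ≈⟨ +-identityʳ D ⟩
        D            ∎

  sqrt : ∀ {D} → 0# ≤ D → Σ Carrier λ s → 0# ≤ s × s * s ≈ D
  sqrt 0≤D = s , 0≤s , ≤.antisym s*s≤D D≤s*s
    where open SquareRoot 0≤D

  1-x≉0⊎-x≉0 : ∀ x → ¬ (1# - x ≈ 0#) ⊎ ¬ (- x ≈ 0#)
  1-x≉0⊎-x≉0 x with ≤.total x (1# - x)
  ... | inj₁ x≤1-x = inj₁ (λ 1-x≈0 → 1≰0 (≤-resp-≈ (x≈1 1-x≈0) 1-x≈0 x≤1-x))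
    where
    x≈1 : 1# - x ≈ 0# → x ≈ 1#
    x≈1 1-x≈0 = trans (solve 1 (λ x → x := :1 :- (:1 :- x)) refl x) (trans (+-congˡ (-‿cong 1-x≈0)) (trans (+-congˡ -0#≈0#) (+-identityʳ 1#)))
  ... | inj₂ 1-x≤x = inj₂ (λ -x≈0 → 1≰0 (≤-resp-≈ (1-x≈1 -x≈0) (x≈0 -x≈0) 1-x≤x))
    where
    x≈0 : - x ≈ 0# → x ≈ 0#
    x≈0 -x≈0 = trans (sym (-‿involutive x)) (trans (-‿cong -x≈0) -0#≈0#)
    1-x≈1 : - x ≈ 0# → 1# - x ≈ 1#
    1-x≈1 -x≈0 = trans (+-congˡ -x≈0) (+-identityʳ 1#)

  -- X ≈ Y from hypotheses pᵢ ≈ qᵢ and a ring identity X ≈ Y + Σ aᵢ * (pᵢ - qᵢ) left to the solver.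
  private
    *-[-]≈0 : ∀ {p q} a → p ≈ q → a * (p - q) ≈ 0#
    *-[-]≈0 {p} {q} a p≈q = trans (*-congˡ (trans (+-congʳ p≈q) (-‿inverseʳ q))) (zeroʳ a)

  linear-combination₁ : ∀ {X Y p₁ q₁} a₁ → X ≈ Y + a₁ * (p₁ - q₁) → p₁ ≈ q₁ → X ≈ Y
  linear-combination₁ a₁ eq h₁ = trans eq (trans (+-congˡ (*-[-]≈0 a₁ h₁)) (+-identityʳ _))

  linear-combination₂ : ∀ {X Y p₁ q₁ p₂ q₂} a₁ a₂ → X ≈ Y + (a₁ * (p₁ - q₁) + a₂ * (p₂ - q₂)) →
                        p₁ ≈ q₁ → p₂ ≈ q₂ → X ≈ Y
  linear-combination₂ a₁ a₂ eq h₁ h₂ =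
    linear-combination₁ a₂ (trans eq (+-congˡ (trans (+-congʳ (*-[-]≈0 a₁ h₁)) (+-identityˡ _)))) h₂

  linear-combination₃ : ∀ {X Y p₁ q₁ p₂ q₂ p₃ q₃} a₁ a₂ a₃ →
                        X ≈ Y + (a₁ * (p₁ - q₁) + a₂ * (p₂ - q₂) + a₃ * (p₃ - q₃)) →
                        p₁ ≈ q₁ → p₂ ≈ q₂ → p₃ ≈ q₃ → X ≈ Y
  linear-combination₃ a₁ a₂ a₃ eq h₁ h₂ h₃ =
    linear-combination₂ a₂ a₃ (trans eq (+-congˡ (+-congʳ (trans (+-congʳ (*-[-]≈0 a₁ h₁)) (+-identityˡ _))))) h₂ h₃

  linear-combination₄ : ∀ {X Y p₁ q₁ p₂ q₂ p₃ q₃ p₄ q₄} a₁ a₂ a₃ a₄ →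
                        X ≈ Y + (a₁ * (p₁ - q₁) + a₂ * (p₂ - q₂) + a₃ * (p₃ - q₃) + a₄ * (p₄ - q₄)) →
                        p₁ ≈ q₁ → p₂ ≈ q₂ → p₃ ≈ q₃ → p₄ ≈ q₄ → X ≈ Y
  linear-combination₄ a₁ a₂ a₃ a₄ eq h₁ h₂ h₃ h₄ =
    linear-combination₃ a₂ a₃ a₄ (trans eq (+-congˡ (+-congʳ (+-congʳ (trans (+-congʳ (*-[-]≈0 a₁ h₁)) (+-identityˡ _)))))) h₂ h₃ h₄

  Σ-cong : ∀ {n} {f g : Fin n → Carrier} → (∀ i → f i ≈ g i) → Σ[ n ] f ≈ Σ[ n ] g
  Σ-cong {zero}  f≈g = refl
  Σ-cong {suc n} f≈g = +-cong (f≈g zero) (Σ-cong (λ i → f≈g (suc i)))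

  Σ-zero : ∀ n → Σ[ n ] (λ _ → 0#) ≈ 0#
  Σ-zero zero    = refl
  Σ-zero (suc n) = trans (+-identityˡ _) (Σ-zero n)

  Σ-+ : ∀ {n} (f g : Fin n → Carrier) → Σ[ n ] (λ i → f i + g i) ≈ Σ[ n ] f + Σ[ n ] g
  Σ-+ {zero}  f g = sym (+-identityˡ 0#)
  Σ-+ {suc n} f g = trans (+-congˡ (Σ-+ (λ i → f (suc i)) (λ i → g (suc i))))
    (solve 4 (λ a b c d → (a :+ b) :+ (c :+ d) := (a :+ c) :+ (b :+ d)) refl (f zero) (g zero) _ _)

  Σ-*ˡ : ∀ {n} c (f : Fin n → Carrier) → Σ[ n ] (λ i → c * f i) ≈ c * Σ[ n ] f
  Σ-*ˡ {zero}  c f = sym (zeroʳ c)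
  Σ-*ˡ {suc n} c f = trans (+-congˡ (Σ-*ˡ c (λ i → f (suc i)))) (sym (distribˡ _ _ _))

  Σ-*ʳ : ∀ {n} c (f : Fin n → Carrier) → Σ[ n ] (λ i → f i * c) ≈ Σ[ n ] f * c
  Σ-*ʳ {n} c f = trans (Σ-cong {n} (λ i → *-comm _ _)) (trans (Σ-*ˡ c f) (*-comm _ _))

  Σ-neg : ∀ {n} (f : Fin n → Carrier) → Σ[ n ] (λ i → - f i) ≈ - Σ[ n ] f
  Σ-neg {zero}  f = sym -0#≈0#
  Σ-neg {suc n} f = trans (+-congˡ (Σ-neg (λ i → f (suc i)))) (-‿+-comm _ _)

  Σ-- : ∀ {n} (f g : Fin n → Carrier) → Σ[ n ] (λ i → f i - g i) ≈ Σ[ n ] f - Σ[ n ] g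
  Σ-- f g = trans (Σ-+ f (λ i → - g i)) (+-congˡ (Σ-neg g))

  Σ-const : ∀ n c → Σ[ n ] (λ _ → c) ≈ ι n * c
  Σ-const zero    c = sym (zeroˡ c)
  Σ-const (suc n) c = trans (+-congˡ (Σ-const n c)) (solve 2 (λ c a → c :+ a :* c := (:1 :+ a) :* c) refl c (ι n))

  Σ-comm : ∀ {n m} (f : Fin n → Fin m → Carrier) →
           Σ[ n ] (λ i → Σ[ m ] (f i)) ≈ Σ[ m ] (λ j → Σ[ n ] (λ i → f i j))
  Σ-comm {zero}  {m} f = sym (Σ-zero m)
  Σ-comm {suc n} {m} f = trans (+-congˡ (Σ-comm (λ i → f (suc i))))
    (sym (Σ-+ (f zero) (λ j → Σ[ n ] (λ i → f (suc i) j))))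

  Σ-nonneg : ∀ {n} {f : Fin n → Carrier} → (∀ i → 0# ≤ f i) → 0# ≤ Σ[ n ] f
  Σ-nonneg {zero}  p = ≤.refl
  Σ-nonneg {suc n} p = +-nonneg (p zero) (Σ-nonneg (λ i → p (suc i)))

  Σ-mono-≤ : ∀ {n} {f g : Fin n → Carrier} → (∀ i → f i ≤ g i) → Σ[ n ] f ≤ Σ[ n ] g
  Σ-mono-≤ {zero}  p = ≤.refl
  Σ-mono-≤ {suc n} p = +-mono-≤ (p zero) (Σ-mono-≤ (λ i → p (suc i)))

  term≤Σ : ∀ {n} {f : Fin n → Carrier} → (∀ i → 0# ≤ f i) → ∀ i → f i ≤ Σ[ n ] f
  term≤Σ {suc n} p zero    = ≤-resp-≈ (+-identityʳ _) refl (+-mono-≤ ≤.refl (Σ-nonneg (λ i → p (suc i))))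
  term≤Σ {suc n} p (suc i) = ≤-resp-≈ (+-identityˡ _) refl (+-mono-≤ (p zero) (term≤Σ (λ i → p (suc i)) i))

  Σ-nonneg≈0⇒≈0 : ∀ {n} {f : Fin n → Carrier} → (∀ i → 0# ≤ f i) → Σ[ n ] f ≈ 0# → ∀ i → f i ≈ 0#
  Σ-nonneg≈0⇒≈0 p Σ≈0 i = ≤.antisym (≤-resp-≈ refl Σ≈0 (term≤Σ p i)) (p i)

  indicator : Bool → Carrier
  indicator b = if b then 1# else 0#

  Σ-indicator : ∀ {n} (p : Fin n → Bool) → Σ[ n ] (λ j → indicator (p j)) ≈ ι (count p)
  Σ-indicator {zero}  p = refl
  Σ-indicator {suc n} p with p zero
  ... | true  = +-congˡ (Σ-indicator (λ j → p (suc j)))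
  ... | false = trans (+-congˡ (Σ-indicator (λ j → p (suc j)))) (+-identityˡ _)

  δ : ∀ {n} → Matrix n
  δ = identityMatrix R

  δ-diag : ∀ {n} (i : Fin n) → δ i i ≈ 1#
  δ-diag i = reflexive (≡.cong indicator (dec-true (i Fin.≟ i) ≡.refl))

  δ-off : ∀ {n} {i j : Fin n} → i ≢ j → δ i j ≈ 0#
  δ-off {i = i} {j} i≢j = reflexive (≡.cong indicator (dec-false (i Fin.≟ j) i≢j))

  δ-sym : ∀ {n} (i j : Fin n) → δ i j ≈ δ j i
  δ-sym i j with i Fin.≟ j
  ... | yes ≡.refl = sym (δ-diag i)
  ... | no i≢j     = sym (δ-off (λ j≡i → i≢j (≡.sym j≡i)))

  Σ-δˡ : ∀ {n} (i : Fin n) (f : Fin n → Carrier) → Σ[ n ] (λ j → δ i j * f j) ≈ f i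
  Σ-δˡ {suc n} zero    f = trans (+-cong (*-identityˡ _) (trans (Σ-cong (λ j → zeroˡ (f (suc j)))) (Σ-zero n))) (+-identityʳ _)
  Σ-δˡ {suc n} (suc i) f = trans (+-cong (zeroˡ _) (Σ-δˡ i (λ j → f (suc j)))) (+-identityˡ _)

  Σ-δʳ : ∀ {n} (i : Fin n) (f : Fin n → Carrier) → Σ[ n ] (λ j → f j * δ j i) ≈ f i
  Σ-δʳ i f = trans (Σ-cong (λ j → trans (*-comm _ _) (*-congʳ (δ-sym j i)))) (Σ-δˡ i f)

  infixl 7 _·_
  _·_ : ∀ {n} → Matrix n → (Fin n → Carrier) → Fin n → Carrier
  _·_ {n} M v i = Σ[ n ] (λ j → M i j * v j)

  ⟨_,_⟩ : ∀ {n} → (Fin n → Carrier) → (Fin n → Carrier) → Carrier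
  ⟨_,_⟩ {n} u v = Σ[ n ] (λ i → u i * v i)

  _⊖ᴵ_ : ∀ {n} → Matrix n → Carrier → Matrix n
  M ⊖ᴵ a = _⊖_ R M (scale R a (identityMatrix R))

  Symmetric : ∀ {n} → Matrix n → Set
  Symmetric M = ∀ i j → M i j ≈ M j i

  PositiveSemidefinite : ∀ {n} → Matrix n → Set
  PositiveSemidefinite M = ∀ v → 0# ≤ ⟨ v , M · v ⟩

  ·-cong : ∀ {n} (M : Matrix n) {u v} → (∀ j → u j ≈ v j) → ∀ i → (M · u) i ≈ (M · v) i
  ·-cong {n} M u≈v i = Σ-cong {n} (λ j → *-congˡ (u≈v j))

  ·-linear : ∀ {n} (M : Matrix n) a w y i → (M · (λ j → a * w j - y j)) i ≈ a * (M · w) i - (M · y) i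
  ·-linear {n} M a w y i = begin
    Σ[ n ] (λ j → M i j * (a * w j - y j))        ≈⟨ Σ-cong {n} (λ j → solve 4 (λ m a w y → m :* (a :* w :- y) := a :* (m :* w) :- m :* y) refl (M i j) a (w j) (y j)) ⟩
    Σ[ n ] (λ j → a * (M i j * w j) - M i j * y j) ≈⟨ Σ-- (λ j → a * (M i j * w j)) (λ j → M i j * y j) ⟩
    Σ[ n ] (λ j → a * (M i j * w j)) - (M · y) i   ≈⟨ +-congʳ (Σ-*ˡ a (λ j → M i j * w j)) ⟩
    a * (M · w) i - (M · y) i                      ∎

  ⊖ᴵ-· : ∀ {n} (M : Matrix n) a v i → ((M ⊖ᴵ a) · v) i ≈ (M · v) i - a * v i
  ⊖ᴵ-· {n} M a v i = begin
    Σ[ n ] (λ j → (M i j - a * δ i j) * v j)        ≈⟨ Σ-cong {n} (λ j → solve 4 (λ m a d v → (m :- a :* d) :* v := m :* v :- a :* (d :* v)) refl (M i j) a (δ i j) (v j)) ⟩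
    Σ[ n ] (λ j → M i j * v j - a * (δ i j * v j)) ≈⟨ Σ-- (λ j → M i j * v j) (λ j → a * (δ i j * v j)) ⟩
    (M · v) i - Σ[ n ] (λ j → a * (δ i j * v j))   ≈⟨ +-congˡ (-‿cong (trans (Σ-*ˡ a (λ j → δ i j * v j)) (*-congˡ (Σ-δˡ i v)))) ⟩
    (M · v) i - a * v i                            ∎

  ⊖ᴵ-symmetric : ∀ {n} {M : Matrix n} a → Symmetric M → Symmetric (M ⊖ᴵ a)
  ⊖ᴵ-symmetric a M-sym i j = +-cong (M-sym i j) (-‿cong (*-congˡ (δ-sym i j)))

  ⟨⟩-comm : ∀ {n} (u v : Fin n → Carrier) → ⟨ u , v ⟩ ≈ ⟨ v , u ⟩
  ⟨⟩-comm {n} u v = Σ-cong {n} (λ i → *-comm (u i) (v i))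

  ⟨⟩-linearʳ : ∀ {n} (u : Fin n → Carrier) a v y → ⟨ u , (λ j → a * v j - y j) ⟩ ≈ a * ⟨ u , v ⟩ - ⟨ u , y ⟩
  ⟨⟩-linearʳ {n} u a v y = begin
    Σ[ n ] (λ j → u j * (a * v j - y j))        ≈⟨ Σ-cong {n} (λ j → solve 4 (λ u a v y → u :* (a :* v :- y) := a :* (u :* v) :- u :* y) refl (u j) a (v j) (y j)) ⟩
    Σ[ n ] (λ j → a * (u j * v j) - u j * y j) ≈⟨ Σ-- (λ j → a * (u j * v j)) (λ j → u j * y j) ⟩
    Σ[ n ] (λ j → a * (u j * v j)) - ⟨ u , y ⟩  ≈⟨ +-congʳ (Σ-*ˡ a (λ j → u j * v j)) ⟩
    a * ⟨ u , v ⟩ - ⟨ u , y ⟩                   ∎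

  ⟨⟩-linearˡ : ∀ {n} a (v y : Fin n → Carrier) u → ⟨ (λ j → a * v j - y j) , u ⟩ ≈ a * ⟨ v , u ⟩ - ⟨ y , u ⟩
  ⟨⟩-linearˡ a v y u = trans (⟨⟩-comm _ u) (trans (⟨⟩-linearʳ u a v y) (+-cong (*-congˡ (⟨⟩-comm u v)) (-‿cong (⟨⟩-comm u y))))

  ·-self-adjoint : ∀ {n} {M : Matrix n} → Symmetric M → ∀ u v → ⟨ u , M · v ⟩ ≈ ⟨ M · u , v ⟩
  ·-self-adjoint {n} {M} M-sym u v = begin
    Σ[ n ] (λ i → u i * Σ[ n ] (λ j → M i j * v j))    ≈⟨ Σ-cong {n} (λ i → sym (Σ-*ˡ (u i) (λ j → M i j * v j))) ⟩
    Σ[ n ] (λ i → Σ[ n ] (λ j → u i * (M i j * v j)))  ≈⟨ Σ-comm (λ i j → u i * (M i j * v j)) ⟩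
    Σ[ n ] (λ j → Σ[ n ] (λ i → u i * (M i j * v j)))  ≈⟨ Σ-cong {n} (λ j → Σ-cong {n} (λ i → trans (solve 3 (λ u m v → u :* (m :* v) := (m :* u) :* v) refl (u i) (M i j) (v j)) (*-congʳ (*-congʳ (M-sym i j))))) ⟩
    Σ[ n ] (λ j → Σ[ n ] (λ i → (M j i * u i) * v j))  ≈⟨ Σ-cong {n} (λ j → Σ-*ʳ (v j) (λ i → M j i * u i)) ⟩
    Σ[ n ] (λ j → (M · u) j * v j)                     ∎

  ⟨⟩-self-nonneg : ∀ {n} (v : Fin n → Carrier) → 0# ≤ ⟨ v , v ⟩
  ⟨⟩-self-nonneg v = Σ-nonneg (λ i → square-nonneg (v i))

  ⟨⟩-self≈0⇒≈0 : ∀ {n} (v : Fin n → Carrier) → ⟨ v , v ⟩ ≈ 0# → ∀ i → v i ≈ 0#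
  ⟨⟩-self≈0⇒≈0 v vv≈0 i = square≈0⇒≈0 (Σ-nonneg≈0⇒≈0 (λ j → square-nonneg (v j)) vv≈0 i)

  -- For y = M w and every m, 0 ≤ ⟨ m w - y , M (m w - y) ⟩ = ⟨ y , M y ⟩ - 2 m ⟨ y , y ⟩, so ⟨ y , y ⟩ ≈ 0.
  psd-kernel : ∀ {n} {M : Matrix n} → Symmetric M → PositiveSemidefinite M →
               ∀ w → ⟨ w , M · w ⟩ ≈ 0# → ∀ i → (M · w) i ≈ 0#
  psd-kernel {n} {M} M-sym M-psd w wMw≈0 = ⟨⟩-self≈0⇒≈0 y (archimedean ⟨ y , M · y ⟩ (⟨⟩-self-nonneg y) bounded)
    where
    y : Fin n → Carrier
    y = M · w
    expand : ∀ a → ⟨ (λ j → a * w j - y j) , M · (λ j → a * w j - y j) ⟩ ≈ ⟨ y , M · y ⟩ - (a * ⟨ y , y ⟩ + a * ⟨ y , y ⟩)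
    expand a = begin
      ⟨ v , M · v ⟩                                                     ≈⟨ Σ-cong {n} (λ j → *-congˡ (·-linear M a w y j)) ⟩
      ⟨ v , (λ j → a * y j - (M · y) j) ⟩                               ≈⟨ ⟨⟩-linearʳ v a y (M · y) ⟩
      a * ⟨ v , y ⟩ - ⟨ v , M · y ⟩                                     ≈⟨ +-cong (*-congˡ (⟨⟩-linearˡ a w y y)) (-‿cong (⟨⟩-linearˡ a w y (M · y))) ⟩
      a * (a * ⟨ w , y ⟩ - ⟨ y , y ⟩) - (a * ⟨ w , M · y ⟩ - ⟨ y , M · y ⟩) ≈⟨ +-cong (*-congˡ (+-congʳ (*-congˡ wMw≈0))) (-‿cong (+-congʳ (*-congˡ (·-self-adjoint M-sym w y)))) ⟩
      a * (a * 0# - ⟨ y , y ⟩) - (a * ⟨ y , y ⟩ - ⟨ y , M · y ⟩)      ≈⟨ solve 3 (λ a d q → a :* (a :* :0 :- d) :- (a :* d :- q) := q :- (a :* d :+ a :* d)) refl a ⟨ y , y ⟩ ⟨ y , M · y ⟩ ⟩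
      ⟨ y , M · y ⟩ - (a * ⟨ y , y ⟩ + a * ⟨ y , y ⟩)                   ∎
      where
      v : Fin n → Carrier
      v j = a * w j - y j
    bounded : ∀ m → ι m * ⟨ y , y ⟩ ≤ ⟨ y , M · y ⟩
    bounded m = ≤.trans (≤-resp-≈ (+-identityʳ _) refl (+-mono-≤ ≤.refl 0≤my))
                        (0≤y-x⇒x≤y (nonneg-resp-≈ (expand (ι m)) (M-psd _)))
      where
      0≤my : 0# ≤ ι m * ⟨ y , y ⟩
      0≤my = *-nonneg (ι-nonneg m) (⟨⟩-self-nonneg y)

  psd-shift⇒≤eigenvalue : ∀ {n} {M : Matrix n} {r t} → PositiveSemidefinite (M ⊖ᴵ r) → IsEigenvalue M t → r ≤ t
  psd-shift⇒≤eigenvalue {n} {M} {r} {t} psd (v , (i , vᵢ≉0) , Mv≈tv) =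
    0≤y-x⇒x≤y (nonneg-*-cancelˡ vv-pos (nonneg-resp-≈ eq (psd v)))
    where
    vv-pos : Positive ⟨ v , v ⟩
    vv-pos = ⟨⟩-self-nonneg v , λ vv≈0 → vᵢ≉0 (⟨⟩-self≈0⇒≈0 v vv≈0 i)
    eq : ⟨ v , (M ⊖ᴵ r) · v ⟩ ≈ ⟨ v , v ⟩ * (t - r)
    eq = trans (Σ-cong {n} (λ j → trans (*-congˡ (trans (⊖ᴵ-· M r v j) (+-congʳ (Mv≈tv j))))
                                         (solve 3 (λ v t r → v :* (t :* v :- r :* v) := (v :* v) :* (t :- r)) refl (v j) t r)))
               (Σ-*ʳ (t - r) (λ j → v j * v j))

  Gram : ∀ {n p} → (Fin n → Fin p → Carrier) → Matrix n
  Gram {p = p} W u v = Σ[ p ] (λ c → W u c * W v c)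

  ⊗-Gram : ∀ {n p} (M : Matrix n) (W : Fin n → Fin p → Carrier) u v →
           _⊗_ R M (Gram W) u v ≈ Σ[ p ] (λ c → (M · (λ z → W z c)) u * W v c)
  ⊗-Gram {n} {p} M W u v = begin
    Σ[ n ] (λ z → M u z * Σ[ p ] (λ c → W z c * W v c))     ≈⟨ Σ-cong {n} (λ z → sym (Σ-*ˡ (M u z) (λ c → W z c * W v c))) ⟩
    Σ[ n ] (λ z → Σ[ p ] (λ c → M u z * (W z c * W v c)))   ≈⟨ Σ-comm (λ z c → M u z * (W z c * W v c)) ⟩
    Σ[ p ] (λ c → Σ[ n ] (λ z → M u z * (W z c * W v c)))   ≈⟨ Σ-cong {p} (λ c → trans (Σ-cong {n} (λ z → sym (*-assoc _ _ _))) (Σ-*ʳ (W v c) (λ z → M u z * W z c))) ⟩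
    Σ[ p ] (λ c → (M · (λ z → W z c)) u * W v c)            ∎

  -- tr (M W Wᵀ) is the sum over the columns w of W of ⟨ w , M w ⟩ ≥ 0, so every M w vanishes.
  psd-trace-Gram≈0 : ∀ {n p} {M : Matrix n} → Symmetric M → PositiveSemidefinite M →
                     ∀ (W : Fin n → Fin p → Carrier) → Σ[ n ] (λ u → _⊗_ R M (Gram W) u u) ≈ 0# →
                     ∀ u v → _⊗_ R M (Gram W) u v ≈ 0#
  psd-trace-Gram≈0 {n} {p} {M} M-sym M-psd W trace≈0 u v =
    trans (⊗-Gram M W u v) (trans (Σ-cong {p} (λ c → trans (*-congʳ (Mw≈0 c u)) (zeroˡ _))) (Σ-zero p))
    where
    column : Fin p → Fin n → Carrier
    column c z = W z c
    trace≈ : Σ[ n ] (λ u → _⊗_ R M (Gram W) u u) ≈ Σ[ p ] (λ c → ⟨ column c , M · column c ⟩)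
    trace≈ = begin
      Σ[ n ] (λ u → _⊗_ R M (Gram W) u u)                        ≈⟨ Σ-cong {n} (λ u → ⊗-Gram M W u u) ⟩
      Σ[ n ] (λ u → Σ[ p ] (λ c → (M · column c) u * W u c))     ≈⟨ Σ-comm (λ u c → (M · column c) u * W u c) ⟩
      Σ[ p ] (λ c → ⟨ M · column c , column c ⟩)                 ≈⟨ Σ-cong {p} (λ c → ⟨⟩-comm (M · column c) (column c)) ⟩
      Σ[ p ] (λ c → ⟨ column c , M · column c ⟩)                 ∎
    Mw≈0 : ∀ c → ∀ u → (M · column c) u ≈ 0#
    Mw≈0 c = psd-kernel M-sym M-psd (column c) (Σ-nonneg≈0⇒≈0 (λ c → M-psd (column c)) (trans (sym trace≈) trace≈0) c)

  ⊗-scaleʳ : ∀ {n} (M F F′ : Matrix n) s → (∀ u v → F u v ≈ s * F′ u v) → ∀ x y → _⊗_ R M F x y ≈ s * _⊗_ R M F′ x y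
  ⊗-scaleʳ {n} M F F′ s F≈sF′ x y =
    trans (Σ-cong {n} (λ z → trans (*-congˡ (F≈sF′ z y)) (solve 3 (λ m s f → m :* (s :* f) := s :* (m :* f)) refl (M x z) s (F′ z y))))
          (Σ-*ˡ s (λ z → M x z * F′ z y))

  module AdjacencyMatrix {n} (G : Graph n) where
    A : Matrix n
    A = adjacencyMatrix R G

    A-sym : Symmetric A
    A-sym i j = reflexive (≡.cong indicator (adj-sym G i j))

    A-diag : ∀ i → A i i ≈ 0#
    A-diag i = reflexive (≡.cong indicator (irrefl G i))

    A-adj : ∀ {i j} → adj G i j ≡ true → A i j ≈ 1#
    A-adj i~j = reflexive (≡.cong indicator i~j)

    A-nonadj : ∀ {i j} → adj G i j ≡ false → A i j ≈ 0#
    A-nonadj i≁j = reflexive (≡.cong indicator i≁j)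

    A-nonneg : ∀ i j → 0# ≤ A i j
    A-nonneg i j with adj G i j
    ... | true  = 0≤1
    ... | false = ≤.refl

    A-≤1 : ∀ i j → A i j ≤ 1#
    A-≤1 i j with adj G i j
    ... | true  = ≤.refl
    ... | false = 0≤1

  module StronglyRegular {n} (G : Graph n) {k l m} (srg : IsSRG G k l m) where
    open IsSRG srg
    open AdjacencyMatrix G public

    K L M N : Carrier
    K = ι k
    L = ι l
    M = ι m
    N = ι n

    A-row-sum : ∀ i → Σ[ n ] (A i) ≈ K
    A-row-sum i = trans (Σ-indicator (adj G i)) (reflexive (≡.cong ι (regular i)))

    A·-const : ∀ c i → (A · (λ _ → c)) i ≈ K * c
    A·-const c i = trans (Σ-*ʳ c (A i)) (*-congʳ (A-row-sum i))

    Σ-A· : ∀ v → Σ[ n ] (A · v) ≈ K * Σ[ n ] v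
    Σ-A· v = begin
      Σ[ n ] (λ i → Σ[ n ] (λ j → A i j * v j)) ≈⟨ Σ-comm (λ i j → A i j * v j) ⟩
      Σ[ n ] (λ j → Σ[ n ] (λ i → A i j * v j)) ≈⟨ Σ-cong {n} (λ j → Σ-*ʳ (v j) (λ i → A i j)) ⟩
      Σ[ n ] (λ j → Σ[ n ] (λ i → A i j) * v j) ≈⟨ Σ-cong {n} (λ j → *-congʳ (trans (Σ-cong {n} (λ i → A-sym i j)) (A-row-sum j))) ⟩
      Σ[ n ] (λ j → K * v j)                    ≈⟨ Σ-*ˡ K v ⟩
      K * Σ[ n ] v                              ∎

    A·-affine : ∀ f g a d i → (A · (λ j → f j - a * g j - d)) i ≈ (A · f) i - a * (A · g) i - K * d
    A·-affine f g a d i = begin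
      Σ[ n ] (λ j → A i j * (f j - a * g j - d))
        ≈⟨ Σ-cong {n} (λ j → solve 5 (λ A f a g d → A :* (f :- a :* g :- d) := (A :* f :- a :* (A :* g)) :- d :* A) refl (A i j) (f j) a (g j) d) ⟩
      Σ[ n ] (λ j → (A i j * f j - a * (A i j * g j)) - d * A i j)
        ≈⟨ Σ-- (λ j → A i j * f j - a * (A i j * g j)) (λ j → d * A i j) ⟩
      Σ[ n ] (λ j → A i j * f j - a * (A i j * g j)) - Σ[ n ] (λ j → d * A i j)
        ≈⟨ +-cong (Σ-- (λ j → A i j * f j) (λ j → a * (A i j * g j))) (-‿cong (trans (Σ-*ˡ d (A i)) (*-congˡ (A-row-sum i)))) ⟩
      (A · f) i - Σ[ n ] (λ j → a * (A i j * g j)) - d * K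
        ≈⟨ +-cong (+-congˡ (-‿cong (Σ-*ˡ a (λ j → A i j * g j)))) (-‿cong (*-comm d K)) ⟩
      (A · f) i - a * (A · g) i - K * d ∎

    private
      common-neighbours : ∀ i j → Σ[ n ] (λ z → A i z * A z j) ≈ ι (count (λ z → adj G i z ∧ adj G j z))
      common-neighbours i j = trans (Σ-cong {n} (λ z → trans (*-congˡ (A-sym z j)) (indicator-∧ (adj G i z) (adj G j z))))
                                    (Σ-indicator (λ z → adj G i z ∧ adj G j z))
        where
        indicator-∧ : ∀ a b → indicator a * indicator b ≈ indicator (a ∧ b)
        indicator-∧ true  b = *-identityˡ _
        indicator-∧ false b = zeroˡ _

      count-∧-self : ∀ i → count (λ z → adj G i z ∧ adj G i z) ≡ k
      count-∧-self i = ≡.trans (count-cong (λ z → ∧-idem (adj G i z))) (regular i)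
        where
        count-cong : ∀ {n} {p q : Fin n → Bool} → (∀ i → p i ≡ q i) → count p ≡ count q
        count-cong {zero}  p≡q = ≡.refl
        count-cong {suc n} {p} {q} p≡q = ≡.cong₂ (λ b c → (if b then 1 else 0) ℕ.+ c) (p≡q zero) (count-cong (λ i → p≡q (suc i)))

    -- A² = K I + L A + M (J - I - A), written entrywise.
    A²-entry : ∀ i j → Σ[ n ] (λ z → A i z * A z j) ≈ (K - M) * δ i j + (L - M) * A i j + M
    A²-entry i j = by-cases (i Fin.≟ j)
      where
      by-cases : Dec (i ≡ j) → Σ[ n ] (λ z → A i z * A z j) ≈ (K - M) * δ i j + (L - M) * A i j + M
      by-cases (yes ≡.refl) = begin
        Σ[ n ] (λ z → A i z * A z i)          ≈⟨ trans (common-neighbours i i) (reflexive (≡.cong ι (count-∧-self i))) ⟩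
        K                                     ≈⟨ solve 3 (λ K L M → K := (K :- M) :* :1 :+ (L :- M) :* :0 :+ M) refl K L M ⟩
        (K - M) * 1# + (L - M) * 0# + M       ≈⟨ sym (+-congʳ (+-cong (*-congˡ (δ-diag i)) (*-congˡ (A-diag i)))) ⟩
        (K - M) * δ i i + (L - M) * A i i + M ∎
      by-cases (no i≢j) with adj G i j in i~j
      ... | true = begin
        Σ[ n ] (λ z → A i z * A z j)          ≈⟨ trans (common-neighbours i j) (reflexive (≡.cong ι (adjacent i j i≢j i~j))) ⟩
        L                                     ≈⟨ solve 3 (λ K L M → L := (K :- M) :* :0 :+ (L :- M) :* :1 :+ M) refl K L M ⟩
        (K - M) * 0# + (L - M) * 1# + M       ≈⟨ sym (+-congʳ (+-congʳ (*-congˡ (δ-off i≢j)))) ⟩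
        (K - M) * δ i j + (L - M) * 1# + M    ∎
      ... | false = begin
        Σ[ n ] (λ z → A i z * A z j)          ≈⟨ trans (common-neighbours i j) (reflexive (≡.cong ι (nonadj i j i≢j i~j))) ⟩
        M                                     ≈⟨ solve 3 (λ K L M → M := (K :- M) :* :0 :+ (L :- M) :* :0 :+ M) refl K L M ⟩
        (K - M) * 0# + (L - M) * 0# + M       ≈⟨ sym (+-congʳ (+-congʳ (*-congˡ (δ-off i≢j)))) ⟩
        (K - M) * δ i j + (L - M) * 0# + M    ∎

    A·A· : ∀ v i → (A · (A · v)) i ≈ (K - M) * v i + (L - M) * (A · v) i + M * Σ[ n ] v
    A·A· v i = begin
      Σ[ n ] (λ j → A i j * Σ[ n ] (λ z → A j z * v z))
        ≈⟨ Σ-cong {n} (λ j → sym (Σ-*ˡ (A i j) (λ z → A j z * v z))) ⟩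
      Σ[ n ] (λ j → Σ[ n ] (λ z → A i j * (A j z * v z)))
        ≈⟨ Σ-comm (λ j z → A i j * (A j z * v z)) ⟩
      Σ[ n ] (λ z → Σ[ n ] (λ j → A i j * (A j z * v z)))
        ≈⟨ Σ-cong {n} (λ z → trans (Σ-cong {n} (λ j → sym (*-assoc _ _ _))) (Σ-*ʳ (v z) (λ j → A i j * A j z))) ⟩
      Σ[ n ] (λ z → Σ[ n ] (λ j → A i j * A j z) * v z)
        ≈⟨ Σ-cong {n} (λ z → *-congʳ (A²-entry i z)) ⟩
      Σ[ n ] (λ z → ((K - M) * δ i z + (L - M) * A i z + M) * v z)
        ≈⟨ Σ-cong {n} (λ z → solve 6 (λ a b c d e v → (a :* d :+ b :* e :+ c) :* v := a :* (d :* v) :+ (b :* (e :* v) :+ c :* v)) refl (K - M) (L - M) M (δ i z) (A i z) (v z)) ⟩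
      Σ[ n ] (λ z → (K - M) * (δ i z * v z) + ((L - M) * (A i z * v z) + M * v z))
        ≈⟨ Σ-+ (λ z → (K - M) * (δ i z * v z)) (λ z → (L - M) * (A i z * v z) + M * v z) ⟩
      Σ[ n ] (λ z → (K - M) * (δ i z * v z)) + Σ[ n ] (λ z → (L - M) * (A i z * v z) + M * v z)
        ≈⟨ +-cong (trans (Σ-*ˡ (K - M) (λ z → δ i z * v z)) (*-congˡ (Σ-δˡ i v)))
                  (trans (Σ-+ (λ z → (L - M) * (A i z * v z)) (λ z → M * v z)) (+-cong (Σ-*ˡ (L - M) (λ z → A i z * v z)) (Σ-*ˡ M v))) ⟩
      (K - M) * v i + ((L - M) * (A · v) i + M * Σ[ n ] v)
        ≈⟨ sym (+-assoc _ _ _) ⟩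
      (K - M) * v i + (L - M) * (A · v) i + M * Σ[ n ] v ∎

    -- For the roots a, b of t² - (L - M) t - (K - M), the matrix Π = A - a I - c J
    -- is (b - a) times the orthogonal projection onto the b-eigenspace.
    module Eigenprojection (N≉0 : ¬ (N ≈ 0#)) (a b : Carrier) (a+b≈L-M : a + b ≈ L - M)
                           (ab≈M-K : a * b ≈ M - K) (K-a*K-b≈NM : (K - a) * (K - b) ≈ N * M) where
      c : Carrier
      c = (K - a) * N ⁻¹

      c*N≈K-a : c * N ≈ K - a
      c*N≈K-a = trans (*-assoc _ _ _) (trans (*-congˡ (⁻¹-inverseˡ N≉0)) (*-identityʳ _))

      c*[K-b]≈M : c * (K - b) ≈ M
      c*[K-b]≈M = begin
        c * (K - b)                ≈⟨ solve 3 (λ p q i → (p :* i) :* q := (p :* q) :* i) refl (K - a) (K - b) (N ⁻¹) ⟩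
        ((K - a) * (K - b)) * N ⁻¹ ≈⟨ *-congʳ K-a*K-b≈NM ⟩
        (N * M) * N ⁻¹             ≈⟨ solve 3 (λ N m i → (N :* m) :* i := m :* (N :* i)) refl N M (N ⁻¹) ⟩
        M * (N * N ⁻¹)             ≈⟨ *-congˡ (⁻¹-inverse N N≉0) ⟩
        M * 1#                     ≈⟨ *-identityʳ M ⟩
        M                          ∎

      Π : Matrix n
      Π i j = A i j - a * δ i j - c

      Π-sym : Symmetric Π
      Π-sym i j = +-congʳ (+-cong (A-sym i j) (-‿cong (*-congˡ (δ-sym i j))))

      Π-diag : ∀ i → Π i i ≈ - a - c
      Π-diag i = +-congʳ (trans (+-cong (A-diag i) (-‿cong (trans (*-congˡ (δ-diag i)) (*-identityʳ a)))) (+-identityˡ _))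

      Π-adj : ∀ {i j} → adj G i j ≡ true → Π i j ≈ 1# - c
      Π-adj i~j = +-congʳ (trans (+-cong (A-adj i~j) (-‿cong (trans (*-congˡ (δ-off (adj⇒≢ G i~j))) (zeroʳ a))))
                                  (trans (+-congˡ -0#≈0#) (+-identityʳ 1#)))

      Π-nonadj : ∀ {i j} → i ≢ j → adj G i j ≡ false → Π i j ≈ - c
      Π-nonadj i≢j i≁j = trans (+-congʳ (trans (+-cong (A-nonadj i≁j) (-‿cong (trans (*-congˡ (δ-off i≢j)) (zeroʳ a))))
                                                (trans (+-congˡ -0#≈0#) (+-identityʳ 0#))))
                                (+-identityˡ _)

      Π·-expand : ∀ v i → (Π · v) i ≈ (A · v) i - a * v i - c * Σ[ n ] v
      Π·-expand v i = begin
        Σ[ n ] (λ j → (A i j - a * δ i j - c) * v j)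
          ≈⟨ Σ-cong {n} (λ j → solve 5 (λ m a d c v → (m :- a :* d :- c) :* v := (m :* v :- a :* (d :* v)) :- c :* v) refl (A i j) a (δ i j) c (v j)) ⟩
        Σ[ n ] (λ j → (A i j * v j - a * (δ i j * v j)) - c * v j)
          ≈⟨ Σ-- (λ j → A i j * v j - a * (δ i j * v j)) (λ j → c * v j) ⟩
        Σ[ n ] (λ j → A i j * v j - a * (δ i j * v j)) - Σ[ n ] (λ j → c * v j)
          ≈⟨ +-cong (Σ-- (λ j → A i j * v j) (λ j → a * (δ i j * v j))) (-‿cong (Σ-*ˡ c v)) ⟩
        (A · v) i - Σ[ n ] (λ j → a * (δ i j * v j)) - c * Σ[ n ] v
          ≈⟨ +-congʳ (+-congˡ (-‿cong (trans (Σ-*ˡ a (λ j → δ i j * v j)) (*-congˡ (Σ-δˡ i v))))) ⟩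
        (A · v) i - a * v i - c * Σ[ n ] v ∎

      Π-column : ∀ i j → (Π · (λ z → δ z j)) i ≈ Π i j
      Π-column i j = Σ-δʳ j (Π i)

      Σ-Π· : ∀ v → Σ[ n ] (Π · v) ≈ 0#
      Σ-Π· v = begin
        Σ[ n ] (Π · v)                                              ≈⟨ Σ-cong {n} (Π·-expand v) ⟩
        Σ[ n ] (λ i → (A · v) i - a * v i - c * S)                  ≈⟨ Σ-- (λ i → (A · v) i - a * v i) (λ _ → c * S) ⟩
        Σ[ n ] (λ i → (A · v) i - a * v i) - Σ[ n ] (λ _ → c * S)   ≈⟨ +-cong (Σ-- (A · v) (λ i → a * v i)) (-‿cong (Σ-const n _)) ⟩
        (Σ[ n ] (A · v) - Σ[ n ] (λ i → a * v i)) - N * (c * S)    ≈⟨ +-congʳ (+-cong (Σ-A· v) (-‿cong (Σ-*ˡ a v))) ⟩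
        (K * S - a * S) - N * (c * S)                               ≈⟨ linear-combination₁ S (solve 5 (λ K a S N c → (K :* S :- a :* S) :- N :* (c :* S) := :0 :+ S :* ((K :- a) :- c :* N)) refl K a S N c) (sym c*N≈K-a) ⟩
        0#                                                          ∎
        where
        S : Carrier
        S = Σ[ n ] v

      Π·Π· : ∀ v i → (Π · (Π · v)) i ≈ (b - a) * (Π · v) i
      Π·Π· v i = begin
        (Π · y) i
          ≈⟨ Π·-expand y i ⟩
        (A · y) i - a * y i - c * Σ[ n ] y
          ≈⟨ +-cong (+-cong (trans (·-cong A (Π·-expand v) i) (A·-affine (A · v) v a (c * S) i)) (-‿cong (*-congˡ (Π·-expand v i))))
                    (-‿cong (trans (*-congˡ (Σ-Π· v)) (zeroʳ c))) ⟩
        ((A · (A · v)) i - a * Av - K * (c * S)) - a * (Av - a * vi - c * S) - 0#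
          ≈⟨ +-congʳ (+-congʳ (+-congʳ (+-congʳ (A·A· v i)))) ⟩
        ((K - M) * vi + (L - M) * Av + M * S - a * Av - K * (c * S)) - a * (Av - a * vi - c * S) - 0#
          ≈⟨ linear-combination₃ vi (- Av) (- S) (solve 9 (λ K L M a b c vi Av S →
               ((K :- M) :* vi :+ (L :- M) :* Av :+ M :* S :- a :* Av :- K :* (c :* S)) :- a :* (Av :- a :* vi :- c :* S) :- :0
               := (b :- a) :* (Av :- a :* vi :- c :* S) :+ (vi :* (a :* b :- (M :- K)) :+ (:- Av) :* ((a :+ b) :- (L :- M)) :+ (:- S) :* (c :* (K :- b) :- M)))
               refl K L M a b c vi Av S) ab≈M-K a+b≈L-M c*[K-b]≈M ⟩
        (b - a) * (Av - a * vi - c * S)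
          ≈⟨ *-congˡ (sym (Π·-expand v i)) ⟩
        (b - a) * y i ∎
        where
        y : Fin n → Carrier
        y = Π · v
        S vi Av : Carrier
        S = Σ[ n ] v
        vi = v i
        Av = (A · v) i

      A·Π· : ∀ v i → (A · (Π · v)) i ≈ b * (Π · v) i
      A·Π· v i = begin
        (A · y) i                                ≈⟨ solve 4 (λ p a q r → p := (p :- a :- r) :+ a :+ r) refl ((A · y) i) (a * y i) (c * Σ[ n ] y) (c * Σ[ n ] y) ⟩
        ((A · y) i - a * y i - c * Σ[ n ] y) + a * y i + c * Σ[ n ] y
                                                 ≈⟨ +-cong (+-congʳ (trans (sym (Π·-expand y i)) (Π·Π· v i))) (trans (*-congˡ (Σ-Π· v)) (zeroʳ c)) ⟩
        (b - a) * y i + a * y i + 0#             ≈⟨ solve 3 (λ a b y → (b :- a) :* y :+ a :* y :+ :0 := b :* y) refl a b (y i) ⟩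
        b * y i                                  ∎
        where
        y : Fin n → Carrier
        y = Π · v

      ⟨Π·,Π·⟩ : ∀ v → ⟨ Π · v , Π · v ⟩ ≈ (b - a) * ⟨ v , Π · v ⟩
      ⟨Π·,Π·⟩ v = begin
        ⟨ Π · v , Π · v ⟩                     ≈⟨ sym (·-self-adjoint Π-sym v (Π · v)) ⟩
        ⟨ v , Π · (Π · v) ⟩                   ≈⟨ Σ-cong {n} (λ i → trans (*-congˡ (Π·Π· v i)) (solve 3 (λ v d y → v :* (d :* y) := d :* (v :* y)) refl (v i) (b - a) ((Π · v) i))) ⟩
        Σ[ n ] (λ i → (b - a) * (v i * (Π · v) i)) ≈⟨ Σ-*ˡ (b - a) (λ i → v i * (Π · v) i) ⟩
        (b - a) * ⟨ v , Π · v ⟩               ∎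

      ⟨⟩-Π-nonneg : 0# ≤ b - a → ∀ v → 0# ≤ ⟨ v , Π · v ⟩
      ⟨⟩-Π-nonneg 0≤b-a v with ≤.total 0# ⟨ v , Π · v ⟩
      ... | inj₁ 0≤q = 0≤q
      ... | inj₂ q≤0 = ≤.reflexive (sym q≈0)
        where
        ⟨Πv,Πv⟩≈0 : ⟨ Π · v , Π · v ⟩ ≈ 0#
        ⟨Πv,Πv⟩≈0 = ≤.antisym (≤-resp-≈ (sym (⟨Π·,Π·⟩ v)) refl (0≤-x⇒x≤0 (nonneg-resp-≈ (sym (-‿distribʳ-* _ _)) (*-nonneg 0≤b-a (x≤0⇒0≤-x q≤0)))))
                              (⟨⟩-self-nonneg (Π · v))
        q≈0 : ⟨ v , Π · v ⟩ ≈ 0#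
        q≈0 = trans (Σ-cong {n} (λ i → trans (*-congˡ (⟨⟩-self≈0⇒≈0 (Π · v) ⟨Πv,Πv⟩≈0 i)) (zeroʳ _))) (Σ-zero n)

      A⊖ᴵa-psd : 0# ≤ b - a → 0# ≤ K - a → PositiveSemidefinite (A ⊖ᴵ a)
      A⊖ᴵa-psd 0≤b-a 0≤K-a v = nonneg-resp-≈ (sym split) (+-nonneg (⟨⟩-Π-nonneg 0≤b-a v) (nonneg-resp-≈ (sym (*-assoc c S S)) (*-nonneg 0≤c (square-nonneg S))))
        where
        S : Carrier
        S = Σ[ n ] v
        0≤c : 0# ≤ c
        0≤c = *-nonneg 0≤K-a (proj₁ (⁻¹-positive (ι-nonneg n , N≉0)))
        split : ⟨ v , (A ⊖ᴵ a) · v ⟩ ≈ ⟨ v , Π · v ⟩ + (c * S) * S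
        split = begin
          Σ[ n ] (λ i → v i * ((A ⊖ᴵ a) · v) i)
            ≈⟨ Σ-cong {n} (λ i → *-congˡ (trans (⊖ᴵ-· A a v i) (solve 2 (λ p r → p := (p :- r) :+ r) refl ((A · v) i - a * v i) (c * S)))) ⟩
          Σ[ n ] (λ i → v i * (((A · v) i - a * v i - c * S) + c * S))
            ≈⟨ Σ-cong {n} (λ i → trans (distribˡ _ _ _) (+-cong (*-congˡ (sym (Π·-expand v i))) (*-comm _ _))) ⟩
          Σ[ n ] (λ i → v i * (Π · v) i + (c * S) * v i)
            ≈⟨ Σ-+ (λ i → v i * (Π · v) i) (λ i → (c * S) * v i) ⟩
          ⟨ v , Π · v ⟩ + Σ[ n ] (λ i → (c * S) * v i)
            ≈⟨ +-congˡ (Σ-*ˡ (c * S) v) ⟩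
          ⟨ v , Π · v ⟩ + (c * S) * S ∎

    module Nontrivial {x} (neighbour : Σ (Fin n) λ z → adj G x z ≡ true)
                      (non-neighbour : Σ (Fin n) λ w → w ≢ x × adj G x w ≡ false) where
      private
        z w : Fin n
        z = proj₁ neighbour
        w = proj₁ non-neighbour
        x~z : adj G x z ≡ true
        x~z = proj₂ neighbour
        w≢x : w ≢ x
        w≢x = proj₁ (proj₂ non-neighbour)
        x≁w : adj G x w ≡ false
        x≁w = proj₂ (proj₂ non-neighbour)

      N-pos : Positive N
      N-pos = 1≤⇒positive (≤-resp-≈ refl (trans (Σ-const n 1#) (*-identityʳ N)) (term≤Σ {n} {λ _ → 1#} (λ _ → 0≤1) x))

      K-pos : Positive K
      K-pos = 1≤⇒positive (≤-resp-≈ (A-adj x~z) (A-row-sum x) (term≤Σ (A-nonneg x) z))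

      -- w is counted by Σⱼ (1 - A x j - δ x j) = N - K - 1, whose terms are all non-negative.
      N-K-1-pos : Positive (N - K - 1#)
      N-K-1-pos = 1≤⇒positive (≤-resp-≈ t-w≈1 Σt≈N-K-1 (term≤Σ t-nonneg w))
        where
        t : Fin n → Carrier
        t j = 1# - A x j - δ x j
        t-nonneg : ∀ j → 0# ≤ t j
        t-nonneg j = by-cases (x Fin.≟ j)
          where
          by-cases : Dec (x ≡ j) → 0# ≤ t j
          by-cases (yes ≡.refl) = nonneg-resp-≈ (sym (trans (+-cong (+-congˡ (-‿cong (A-diag x))) (-‿cong (δ-diag x)))
                                                             (solve 0 (:1 :- :0 :- :1 := :0) refl))) ≤.refl
          by-cases (no x≢j)     = nonneg-resp-≈ (sym (trans (+-congˡ (-‿cong (δ-off x≢j))) (trans (+-congˡ -0#≈0#) (+-identityʳ _))))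
                                               (x≤y⇒0≤y-x (A-≤1 x j))
        t-w≈1 : t w ≈ 1#
        t-w≈1 = trans (+-cong (+-congˡ (-‿cong (A-nonadj x≁w))) (-‿cong (δ-off (λ x≡w → w≢x (≡.sym x≡w)))))
                      (solve 0 (:1 :- :0 :- :0 := :1) refl)
        Σt≈N-K-1 : Σ[ n ] t ≈ N - K - 1#
        Σt≈N-K-1 = begin
          Σ[ n ] (λ j → 1# - A x j - δ x j)                 ≈⟨ Σ-- (λ j → 1# - A x j) (δ x) ⟩
          Σ[ n ] (λ j → 1# - A x j) - Σ[ n ] (δ x)          ≈⟨ +-cong (Σ-- (λ _ → 1#) (A x)) (-‿cong (trans (Σ-cong {n} (λ j → sym (*-identityʳ _))) (Σ-δˡ x (λ _ → 1#)))) ⟩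
          (Σ[ n ] (λ _ → 1#) - Σ[ n ] (A x)) - 1#           ≈⟨ +-congʳ (+-cong (trans (Σ-const n 1#) (*-identityʳ N)) (-‿cong (A-row-sum x))) ⟩
          N - K - 1#                                        ∎

      private
        common-neighbours≤K : ∀ y → Σ[ n ] (λ j → A x j * A j y) ≤ K
        common-neighbours≤K y = ≤-resp-≈ refl (A-row-sum x)
          (Σ-mono-≤ (λ j → ≤-resp-≈ refl (*-identityʳ _) (*-monoˡ-≤-nonneg (A-nonneg x j) (A-≤1 j y))))

      M≤K : M ≤ K
      M≤K = ≤-resp-≈ Σ≈M refl (common-neighbours≤K w)
        where
        Σ≈M : Σ[ n ] (λ j → A x j * A j w) ≈ M
        Σ≈M = trans (A²-entry x w) (trans (+-congʳ (+-cong (*-congˡ (δ-off (λ x≡w → w≢x (≡.sym x≡w)))) (*-congˡ (A-nonadj x≁w))))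
                                          (solve 3 (λ K L M → (K :- M) :* :0 :+ (L :- M) :* :0 :+ M := M) refl K L M))

      L≤K : L ≤ K
      L≤K = ≤-resp-≈ Σ≈L refl (common-neighbours≤K z)
        where
        Σ≈L : Σ[ n ] (λ j → A x j * A j z) ≈ L
        Σ≈L = trans (A²-entry x z) (trans (+-congʳ (+-cong (*-congˡ (δ-off (adj⇒≢ G x~z))) (*-congˡ (A-adj x~z))))
                                          (solve 3 (λ K L M → (K :- M) :* :0 :+ (L :- M) :* :1 :+ M := L) refl K L M))

      -- A J = K J applied to A² = (K - M) I + (L - M) A + M J.
      K*K≈[K-M]+[L-M]*K+M*N : K * K ≈ (K - M) + (L - M) * K + M * N
      K*K≈[K-M]+[L-M]*K+M*N = begin
        K * K                                           ≈⟨ solve 1 (λ K → K :* K := K :* (K :* :1)) refl K ⟩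
        K * (K * 1#)                                    ≈⟨ sym (A·-const (K * 1#) x) ⟩
        (A · (λ _ → K * 1#)) x                          ≈⟨ sym (·-cong A (λ j → A·-const 1# j) x) ⟩
        (A · (A · (λ _ → 1#))) x                        ≈⟨ A·A· (λ _ → 1#) x ⟩
        (K - M) * 1# + (L - M) * (A · (λ _ → 1#)) x + M * Σ[ n ] (λ _ → 1#)
          ≈⟨ +-cong (+-cong (*-identityʳ _) (*-congˡ (trans (A·-const 1# x) (*-identityʳ K)))) (*-congˡ (trans (Σ-const n 1#) (*-identityʳ N))) ⟩
        (K - M) + (L - M) * K + M * N                   ∎

      two : Carrier
      two = 1# + 1#

      two-pos : Positive two
      two-pos = 1≤⇒positive (≤-resp-≈ (+-identityʳ 1#) refl (+-mono-≤ ≤.refl 0≤1))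

      ½ : Carrier
      ½ = two ⁻¹

      ½*2≈1 : ½ * two ≈ 1#
      ½*2≈1 = ⁻¹-inverseˡ (proj₂ two-pos)

      discriminant : Carrier
      discriminant = (L - M) * (L - M) + ((K - M) + (K - M) + (K - M) + (K - M))

      -- Kept abstract: unfolding the lub-built root makes the solver's conversion checks blow up.
      abstract
        √discriminant : Σ Carrier λ s → 0# ≤ s × s * s ≈ discriminant
        √discriminant = sqrt (+-nonneg (square-nonneg _) (+-nonneg (+-nonneg (+-nonneg 0≤K-M 0≤K-M) 0≤K-M) 0≤K-M))
          where
          0≤K-M : 0# ≤ K - M
          0≤K-M = x≤y⇒0≤y-x M≤K

      s : Carrier
      s = proj₁ √discriminant

      -- The roots of t² - (L - M) t - (K - M), the restricted eigenvalues of A.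
      r r′ : Carrier
      r  = ½ * ((L - M) - s)
      r′ = ½ * ((L - M) + s)

      r+r′≈L-M : r + r′ ≈ L - M
      r+r′≈L-M = linear-combination₁ (L - M)
        (solve 4 (λ h L M s → h :* ((L :- M) :- s) :+ h :* ((L :- M) :+ s) := (L :- M) :+ (L :- M) :* (h :* (:1 :+ :1) :- :1)) refl ½ L M s)
        ½*2≈1

      rr′≈M-K : r * r′ ≈ M - K
      rr′≈M-K = linear-combination₂ (- (½ * ½)) (- ((K - M) * (½ * two + 1#)))
        (solve 5 (λ h L M s K → (h :* ((L :- M) :- s)) :* (h :* ((L :- M) :+ s))
           := (M :- K) :+ (((:- (h :* h)) :* (s :* s :- ((L :- M) :* (L :- M) :+ ((K :- M) :+ (K :- M) :+ (K :- M) :+ (K :- M)))))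
                         :+ ((:- ((K :- M) :* (h :* (:1 :+ :1) :+ :1))) :* (h :* (:1 :+ :1) :- :1)))) refl ½ L M s K)
        (proj₂ (proj₂ √discriminant)) ½*2≈1

      K-r*K-r′≈NM : (K - r) * (K - r′) ≈ N * M
      K-r*K-r′≈NM = linear-combination₃ 1# (- K) 1#
        (solve 6 (λ K L M N r r′ → (K :- r) :* (K :- r′) := N :* M :+ (:1 :* (K :* K :- ((K :- M) :+ (L :- M) :* K :+ M :* N)) :+ (:- K) :* ((r :+ r′) :- (L :- M)) :+ :1 :* (r :* r′ :- (M :- K)))) refl K L M N r r′)
        K*K≈[K-M]+[L-M]*K+M*N r+r′≈L-M rr′≈M-K

      0≤r′-r : 0# ≤ r′ - r
      0≤r′-r = nonneg-resp-≈ (solve 3 (λ h L s → h :* (s :+ s) := h :* (L :+ s) :- h :* (L :- s)) refl ½ (L - M) s)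
                             (*-nonneg (proj₁ (⁻¹-positive two-pos)) (+-nonneg 0≤s 0≤s))
        where
        0≤s : 0# ≤ s
        0≤s = proj₁ (proj₂ √discriminant)

      0≤K-r : 0# ≤ K - r
      0≤K-r = nonneg-resp-≈ (sym eq) (*-nonneg (proj₁ (⁻¹-positive two-pos))
                (+-nonneg (+-nonneg (+-nonneg (x≤y⇒0≤y-x L≤K) (proj₁ K-pos)) (ι-nonneg m)) (proj₁ (proj₂ √discriminant))))
        where
        eq : K - r ≈ ½ * ((K - L) + K + M + s)
        eq = linear-combination₁ (- K) (solve 5 (λ h K L M s → K :- h :* ((L :- M) :- s) := h :* ((K :- L) :+ K :+ M :+ s) :+ (:- K) :* (h :* (:1 :+ :1) :- :1)) refl ½ K L M s) ½*2≈1

      module Πr  = Eigenprojection (proj₂ N-pos) r r′ r+r′≈L-M rr′≈M-K K-r*K-r′≈NM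
      module Πr′ = Eigenprojection (proj₂ N-pos) r′ r (trans (+-comm _ _) r+r′≈L-M) (trans (*-comm _ _) rr′≈M-K) (trans (*-comm _ _) K-r*K-r′≈NM)

      A⊖ᴵr-psd : PositiveSemidefinite (A ⊖ᴵ r)
      A⊖ᴵr-psd = Πr.A⊖ᴵa-psd 0≤r′-r 0≤K-r

      -- Column x of Πr′ is an r-eigenvector; its entries at z and w are 1 - c and - c.
      r-eigenvalue : IsEigenvalue A r
      r-eigenvalue = u , nonzero (1-x≉0⊎-x≉0 Πr′.c) , Πr′.A·Π· eₓ
        where
        eₓ u : Fin n → Carrier
        eₓ j = δ j x
        u = Πr′.Π · eₓ
        nonzero : ¬ (1# - Πr′.c ≈ 0#) ⊎ ¬ (- Πr′.c ≈ 0#) → Σ (Fin n) λ i → ¬ (u i ≈ 0#)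
        nonzero (inj₁ ≉0) = z , λ uz≈0 → ≉0 (trans (sym (trans (Πr′.Π-column z x) (Πr′.Π-adj (≡.trans (adj-sym G z x) x~z)))) uz≈0)
        nonzero (inj₂ ≉0) = w , λ uw≈0 → ≉0 (trans (sym (trans (Πr′.Π-column w x) (Πr′.Π-nonadj w≢x (≡.trans (adj-sym G w x) x≁w)))) uw≈0)

      least-eigenvalue≈r : ∀ {τ} → IsLeastEigenvalue A τ → τ ≈ r
      least-eigenvalue≈r (τ-eigenvalue , τ-least) = ≤.antisym (τ-least r r-eigenvalue) (psd-shift⇒≤eigenvalue A⊖ᴵr-psd τ-eigenvalue)

      A⊖ᴵleast-psd : ∀ {τ} → IsLeastEigenvalue A τ → PositiveSemidefinite (A ⊖ᴵ τ)
      A⊖ᴵleast-psd {τ} τ-least v = nonneg-resp-≈ (Σ-cong {n} (λ i → *-congˡ (r≈τ-entries i))) (A⊖ᴵr-psd v)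
        where
        r≈τ-entries : ∀ i → ((A ⊖ᴵ r) · v) i ≈ ((A ⊖ᴵ τ) · v) i
        r≈τ-entries i = Σ-cong {n} (λ j → *-congʳ (+-congˡ (-‿cong (*-congʳ (sym (least-eigenvalue≈r τ-least))))))

      module CosineMatrix {τ} (τ-least : IsLeastEigenvalue A τ) where
        open Πr′ using (Π; c; Π-sym; Π-diag; Π-adj; Π-nonadj; Π-column; Π·Π·; c*N≈K-a; c*[K-b]≈M)

        E : Matrix n
        E = cosineMatrix R G k τ

        τ≈r : τ ≈ r
        τ≈r = least-eigenvalue≈r τ-least

        off-diagonal : Fin n → Fin n → Carrier
        off-diagonal i j = if adj G i j then adjacencyCosine R k τ else nonAdjacencyCosine R n k τ

        E-diag : ∀ i → E i i ≈ 1#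
        E-diag i = reflexive (≡.cong (λ b → if b then 1# else off-diagonal i i) (dec-true (i Fin.≟ i) ≡.refl))

        E-off : ∀ {i j} → i ≢ j → E i j ≡ off-diagonal i j
        E-off {i} {j} i≢j = ≡.cong (λ b → if b then 1# else off-diagonal i j) (dec-false (i Fin.≟ j) i≢j)

        E-adj : ∀ {i j} → adj G i j ≡ true → E i j ≈ τ * K ⁻¹
        E-adj i~j = reflexive (≡.trans (E-off (adj⇒≢ G i~j)) (≡.cong (λ b → if b then _ else _) i~j))

        E-nonadj : ∀ {i j} → i ≢ j → adj G i j ≡ false → E i j ≈ (- τ - 1#) * (N - K - 1#) ⁻¹
        E-nonadj i≢j i≁j = reflexive (≡.trans (E-off i≢j) (≡.cong (λ b → if b then _ else _) i≁j))

        β : Carrier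
        β = - r′ - c

        -- Where the two cosines come from: the entries 1 - c and - c of Π, rescaled so that the diagonal becomes 1.
        Π≈βE : ∀ i j → Π i j ≈ β * E i j
        Π≈βE i j = by-cases (i Fin.≟ j)
          where
          K⁻¹ D⁻¹ : Carrier
          K⁻¹ = K ⁻¹
          D⁻¹ = (N - K - 1#) ⁻¹
          r′r≈M-K : r′ * r ≈ M - K
          r′r≈M-K = trans (*-comm r′ r) rr′≈M-K
          by-cases : Dec (i ≡ j) → Π i j ≈ β * E i j
          by-cases (yes ≡.refl) = trans (Π-diag i) (trans (sym (*-identityʳ β)) (*-congˡ (sym (E-diag i))))
          by-cases (no i≢j) = by-adjacency (adj G i j) ≡.refl
            where
            by-adjacency : ∀ b → adj G i j ≡ b → Π i j ≈ β * E i j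
            by-adjacency true i∼j = begin
              Π i j             ≈⟨ Π-adj i∼j ⟩
              1# - c            ≈⟨ linear-combination₃ (- (1# - c)) K⁻¹ (- K⁻¹)
                                     (solve 6 (λ c t τ K Ki M → :1 :- c := (:- t :- c) :* (τ :* Ki) :+ ((:- (:1 :- c)) :* (K :* Ki :- :1) :+ Ki :* (t :* τ :- (M :- K)) :+ (:- Ki) :* (c :* (K :- τ) :- M))) refl c r′ r K K⁻¹ M)
                                     (⁻¹-inverse K (proj₂ K-pos)) r′r≈M-K c*[K-b]≈M ⟩
              β * (r * K⁻¹)     ≈⟨ *-congˡ (sym (trans (E-adj i∼j) (*-congʳ τ≈r))) ⟩
              β * E i j         ∎
            by-adjacency false i≁j = begin
              Π i j                        ≈⟨ Π-nonadj i≢j i≁j ⟩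
              - c                          ≈⟨ linear-combination₄ c (- D⁻¹) D⁻¹ (- D⁻¹)
                                                (solve 7 (λ c t τ K N Di M → :- c := (:- t :- c) :* ((:- τ :- :1) :* Di)
                                                   :+ (c :* ((N :- K :- :1) :* Di :- :1) :+ (:- Di) :* (c :* N :- (K :- t)) :+ Di :* (c :* (K :- τ) :- M) :+ (:- Di) :* (t :* τ :- (M :- K))))
                                                   refl c r′ r K N D⁻¹ M)
                                                (⁻¹-inverse _ (proj₂ N-K-1-pos)) c*N≈K-a c*[K-b]≈M r′r≈M-K ⟩
              β * ((- r - 1#) * D⁻¹)       ≈⟨ *-congˡ (sym (trans (E-nonadj i≢j i≁j) (*-congʳ (+-congʳ (-‿cong τ≈r))))) ⟩
              β * E i j                    ∎

        γ : Carrier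
        γ = (r - r′) * β

        Π⊗Π≈γE : ∀ i j → _⊗_ R Π Π i j ≈ γ * E i j
        Π⊗Π≈γE i j = begin
          (Π · (λ z → Π z j)) i              ≈⟨ sym (·-cong Π (λ z → Π-column z j) i) ⟩
          (Π · (Π · (λ z → δ z j))) i        ≈⟨ Π·Π· (λ z → δ z j) i ⟩
          (r - r′) * (Π · (λ z → δ z j)) i   ≈⟨ *-congˡ (trans (Π-column i j) (Π≈βE i j)) ⟩
          (r - r′) * (β * E i j)             ≈⟨ sym (*-assoc _ _ _) ⟩
          γ * E i j                          ∎

        -- If γ ≈ 0 then row x of Π vanishes, but Π x z - Π x w ≈ 1.
        γ≉0 : ¬ (γ ≈ 0#)
        γ≉0 γ≈0 = 0≉1 (sym 1≈0)
          where
          Πx≈0 : ∀ j → Π x j ≈ 0#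
          Πx≈0 = ⟨⟩-self≈0⇒≈0 (Π x) (trans (Σ-cong {n} (λ j → *-congˡ (Π-sym x j))) (trans (Π⊗Π≈γE x x) (trans (*-congʳ γ≈0) (zeroˡ _))))
          1≈0 : 1# ≈ 0#
          1≈0 = begin
            1#                 ≈⟨ solve 1 (λ c → :1 := (:1 :- c) :- (:- c)) refl c ⟩
            (1# - c) - (- c)   ≈⟨ +-cong (trans (sym (Π-adj x~z)) (Πx≈0 z)) (-‿cong (trans (sym (Π-nonadj (λ x≡w → w≢x (≡.sym x≡w)) x≁w)) (Πx≈0 w))) ⟩
            0# - 0#            ≈⟨ trans (+-congˡ -0#≈0#) (+-identityʳ 0#) ⟩
            0#                 ∎

        Gram≈γE : ∀ i j → Gram Π i j ≈ γ * E i j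
        Gram≈γE i j = trans (Σ-cong {n} (λ c → *-congˡ (Π-sym j c))) (Π⊗Π≈γE i j)

        E≈γ⁻¹Gram : ∀ i j → E i j ≈ γ ⁻¹ * Gram Π i j
        E≈γ⁻¹Gram i j = begin
          E i j               ≈⟨ sym (*-identityˡ _) ⟩
          1# * E i j          ≈⟨ *-congʳ (sym (⁻¹-inverseˡ γ≉0)) ⟩
          (γ ⁻¹ * γ) * E i j  ≈⟨ *-assoc _ _ _ ⟩
          γ ⁻¹ * (γ * E i j)  ≈⟨ *-congˡ (sym (Gram≈γE i j)) ⟩
          γ ⁻¹ * Gram Π i j   ∎

  K₁-eigenvalue≈0 : (G : Graph 1) → ∀ {t} → IsEigenvalue (adjacencyMatrix R G) t → t ≈ 0#
  K₁-eigenvalue≈0 G {t} (v , (zero , v₀≉0) , Av≈tv) = begin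
    t                                   ≈⟨ sym (*-identityʳ t) ⟩
    t * 1#                              ≈⟨ *-congˡ (sym (⁻¹-inverse _ v₀≉0)) ⟩
    t * (v zero * v zero ⁻¹)            ≈⟨ sym (*-assoc _ _ _) ⟩
    (t * v zero) * v zero ⁻¹            ≈⟨ *-congʳ (sym (Av≈tv zero)) ⟩
    (A₀₀ * v zero + 0#) * v zero ⁻¹     ≈⟨ *-congʳ (trans (+-identityʳ _) (trans (*-congʳ A₀₀≈0) (zeroˡ _))) ⟩
    0# * v zero ⁻¹                      ≈⟨ zeroˡ _ ⟩
    0#                                  ∎
    where
    A₀₀ = adjacencyMatrix R G zero zero
    A₀₀≈0 : A₀₀ ≈ 0#
    A₀₀≈0 = AdjacencyMatrix.A-diag G zero

  K₁-kernel : (G : Graph 1) → ∀ {τ} → IsEigenvalue (adjacencyMatrix R G) τ → (F : Matrix 1) →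
              IsZeroMatrix R (_⊗_ R (adjacencyMatrix R G ⊖ᴵ τ) F)
  K₁-kernel G {τ} τ-eigenvalue F zero zero = trans (+-identityʳ _) (trans (*-congʳ entry≈0) (zeroˡ _))
    where
    entry≈0 : adjacencyMatrix R G zero zero - τ * δ {1} zero zero ≈ 0#
    entry≈0 = trans (+-cong (AdjacencyMatrix.A-diag G zero) (-‿cong (trans (*-congʳ (K₁-eigenvalue≈0 G τ-eigenvalue)) (zeroˡ _))))
                    (trans (+-identityˡ _) -0#≈0#)

  module Homomorphism {nG nH} {G : Graph nG} {H : Graph nH} {kG lG mG kH lH mH}
                      (srgG : IsSRG G kG lG mG) (srgH : IsSRG H kH lH mH)
                      {x} (neighbourG : Σ (Fin nG) λ z → adj G x z ≡ true)
                      (non-neighbourG : Σ (Fin nG) λ w → w ≢ x × adj G x w ≡ false)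
                      {a} (neighbourH : Σ (Fin nH) λ z → adj H a z ≡ true)
                      (non-neighbourH : Σ (Fin nH) λ w → w ≢ a × adj H a w ≡ false)
                      {τG τH} (τG-least : IsLeastEigenvalue (adjacencyMatrix R G) τG)
                      (τH-least : IsLeastEigenvalue (adjacencyMatrix R H) τH)
                      (cos : adjacencyCosine R kG τG ≈ adjacencyCosine R kH τH)
                      (φ : Fin nG → Fin nH) (hom : IsHomomorphism G H φ) where
    module 𝔾 = StronglyRegular G srgG
    module 𝔾ₙ = 𝔾.Nontrivial neighbourG non-neighbourG
    module ℍ = StronglyRegular H srgH
    module ℍₙ = ℍ.Nontrivial neighbourH non-neighbourH
    open ℍₙ.CosineMatrix τH-least using (E; E-diag; E-adj; γ; Gram≈γE; E≈γ⁻¹Gram)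

    A-τI : Matrix nG
    A-τI = 𝔾.A ⊖ᴵ τG

    Eᵠ : Matrix nG
    Eᵠ = pullback R E φ

    -- φ maps the neighbours of u into those of φ u, so row u of 𝔾.A Eᵠ sums kG copies of τH / kH = τG / kG.
    ⊗-diagonal≈0 : ∀ u → _⊗_ R A-τI Eᵠ u u ≈ 0#
    ⊗-diagonal≈0 u = begin
      (A-τI · e) u                   ≈⟨ ⊖ᴵ-· 𝔾.A τG e u ⟩
      (𝔾.A · e) u - τG * e u         ≈⟨ +-cong (trans (Σ-cong {nG} on-neighbours) (𝔾.A·-const cosH u)) (-‿cong (*-congˡ (E-diag (φ u)))) ⟩
      𝔾.K * cosH - τG * 1#           ≈⟨ +-congʳ (*-congˡ (sym cos)) ⟩
      𝔾.K * (τG * 𝔾.K ⁻¹) - τG * 1#  ≈⟨ linear-combination₁ τG (solve 3 (λ K t Ki → K :* (t :* Ki) :- t :* :1 := :0 :+ t :* (K :* Ki :- :1)) refl 𝔾.K τG (𝔾.K ⁻¹))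
                                                              (⁻¹-inverse _ (proj₂ 𝔾ₙ.K-pos)) ⟩
      0#                             ∎
      where
      e : Fin nG → Carrier
      e v = E (φ v) (φ u)
      cosH : Carrier
      cosH = τH * ℍ.K ⁻¹
      on-neighbours : ∀ v → 𝔾.A u v * e v ≈ 𝔾.A u v * cosH
      on-neighbours v with adj G u v in u~v
      ... | true  = *-congˡ (E-adj (hom v u (≡.trans (adj-sym G v u) u~v)))
      ... | false = trans (zeroˡ _) (sym (zeroˡ _))

    W : Fin nG → Fin nH → Carrier
    W u = ℍₙ.Πr′.Π (φ u)

    [A-τI]Eᵠ≈0 : IsZeroMatrix R (_⊗_ R A-τI Eᵠ)
    [A-τI]Eᵠ≈0 u v = begin
      _⊗_ R A-τI Eᵠ u v               ≈⟨ ⊗-scaleʳ A-τI Eᵠ (Gram W) (γ ⁻¹) (λ u v → E≈γ⁻¹Gram (φ u) (φ v)) u v ⟩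
      γ ⁻¹ * _⊗_ R A-τI (Gram W) u v  ≈⟨ *-congˡ (psd-trace-Gram≈0 A-τI-sym (𝔾ₙ.A⊖ᴵleast-psd τG-least) W trace≈0 u v) ⟩
      γ ⁻¹ * 0#                       ≈⟨ zeroʳ _ ⟩
      0#                              ∎
      where
      A-τI-sym : Symmetric A-τI
      A-τI-sym = ⊖ᴵ-symmetric τG 𝔾.A-sym
      trace≈0 : Σ[ nG ] (λ u → _⊗_ R A-τI (Gram W) u u) ≈ 0#
      trace≈0 = trans (Σ-cong {nG} (λ u → trans (⊗-scaleʳ A-τI (Gram W) Eᵠ γ (λ u v → Gram≈γE (φ u) (φ v)) u u)
                                                (trans (*-congˡ (⊗-diagonal≈0 u)) (zeroʳ γ))))
                      (Σ-zero nG)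

lemma3p3 : (R : RealField)
    → (nG kG lG mG nH kH lH mH : ℕ)
    → (G : Graph nG) → (H : Graph nH)
    → IsSRG G kG lG mG → Primitive G
    → IsSRG H kH lH mH → Primitive H
    → (τG τH : RealField.Carrier R)
    → RealField.IsLeastEigenvalue R (adjacencyMatrix R G) τG
    → RealField.IsLeastEigenvalue R (adjacencyMatrix R H) τH
    → RealField._≈_ R (adjacencyCosine R kG τG) (adjacencyCosine R kH τH)
    → (φ : Fin nG → Fin nH) → IsHomomorphism G H φ
    → IsZeroMatrix R
        (_⊗_ R (_⊖_ R (adjacencyMatrix R G) (scale R τG (identityMatrix R)))
               (pullback R (cosineMatrix R H kH τH) φ))
lemma3p3 R zero _ _ _ _ _ _ _ _ _ _ _ _ _ _ _ _ _ _ _ _ ()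
lemma3p3 R (suc zero) _ _ _ _ kH _ _ G H _ _ _ _ τG τH (τG-eigenvalue , _) _ _ φ _ =
  K₁-kernel R G τG-eigenvalue (pullback R (cosineMatrix R H kH τH) φ)
lemma3p3 R (suc (suc _)) _ _ _ _ _ _ _ G H srgG (G-connected , Gᶜ-connected) srgH (H-connected , Hᶜ-connected)
         τG τH τG-least τH-least cos φ hom =
  Homomorphism.[A-τI]Eᵠ≈0 R srgG srgH (has-neighbour G-connected 0≢1) (has-non-neighbour Gᶜ-connected 0≢1)
                                  (has-neighbour H-connected φ0≢φz) (has-non-neighbour Hᶜ-connected φ0≢φz)
                                  τG-least τH-least cos φ hom
  where
  0≢1 : zero ≢ suc zero
  0≢1 ()
  φ0≢φz : φ zero ≢ φ (proj₁ (has-neighbour G-connected 0≢1))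
  φ0≢φz = adj⇒≢ H (hom _ _ (proj₂ (has-neighbour G-connected 0≢1)))
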